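{- Working in IZF${}_R^-$, the class $T$ of transitively L-stable sets is an inner model of IZF${}_R$: for every axiom $\chi$ of IZF${}_R$ (including every instance of the Leibniz schema L${}_\phi$), IZF${}_R^-\vdash\chi^T$.
   Context: Logic: intuitionistic first-order logic without equality. Language: binary relation $\in$; terms are variables, $\emptyset$, $\omega$, $\{t,u\}$, $\bigcup t$, $P(t)$, $S_{\phi(a,\vec f)}(t,\vec u)$, $R_{\phi(a,b,\vec f)}(t,\vec u)$ (one symbol per formula $\phi$); formulas from $t\in u$, $\bot$ via $\land,\lor,\to,\forall,\exists$. Abbreviations: $t=u$ means $\forall z.\ z\in t\leftrightarrow z\in u$; $0:=\emptyset$; $S(t):=\bigcup\{t,\{t,t\}\}$; $\leftrightarrow$, bounded quantifiers, $\exists!$ as usual. Axioms of IZF${}_R$: (EMPTY) $\forall c.\ c\in\emptyset\leftrightarrow\bot$; (PAIR) $\forall a,b\,\forall c.\ c\in\{a,b\}\leftrightarrow c=a\lor c=b$; (INF) $\forall c.\ c\in\omega\leftrightarrow c=0\lor\exists b\in\omega.\ c=S(b)$; (SEP${}_\phi$) $\forall\vec f,a\,\forall c.\ c\in S_{\phi(a,\vec f)}(a,\vec f)\leftrightarrow c\in a\land\phi(c,\vec f)$; (UNION) $\forall a\,\forall c.\ c\in\bigcup a\leftrightarrow\exists b\in a.\ c\in b$; (POWER) $\forall a\,\forall c.\ c\in P(a)\leftrightarrow\forall b.\ b\in c\to b\in a$; (REPL${}_\phi$) $\forall\vec f,a\,\forall c.\ c\in R_{\phi(a,b,\vec f)}(a,\vec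 f)\leftrightarrow(\forall x\in a\,\exists!y.\ \phi(x,y,\vec f))\land(\exists x\in a.\ \phi(x,c,\vec f))$; (IND${}_\phi$) $\forall\vec f.\ (\forall a.(\forall b\in a.\ \phi(b,\vec f))\to\phi(a,\vec f))\to\forall a.\ \phi(a,\vec f)$; (L${}_\phi$) $\forall\vec f,a,b.\ a=b\to\phi(a,\vec f)\to\phi(b,\vec f)$. IZF${}_R^-$ is IZF${}_R$ without L${}_\phi$. A set $C$ is L-stable if $\forall A,B.\ A\in C\land A=B\to B\in C$. $C$ is transitively L-stable, $TLS(C)$, if $C$ is L-stable and every element of $C$ is transitively L-stable; formally (in IZF${}_R^-$, using transitive closure) every element of the transitive closure of $\{C\}$ is L-stable. $T$ is the class $\{C\mid TLS(C)\}$. Relativization $\phi^T$: atoms $(t\in s)^T := t^T\in s^T$, $\bot^T=\bot$, commutes with $\land,\lor,\to$, $(\forall x.\phi)^T:=\forall x.\ x\in T\to\phi^T$, $(\exists x.\phi)^T:=\exists x.\ x\in T\land\phi^T$; terms: $a^T:=a$, $\emptyset^T:=\emptyset$, $\omega^T:=\omega$, $\{t,u\}^T:=\{t^T,u^T\}$, $(\bigcup t)^T:=\bigcup t^T$, $(P(t))^T:=P(t^T)\cap T$ (i.e. the separation $\{x\in P(t^T)\mid TLS(x)\}$), $(S_{\phi(a,\vec f)}(t,\vec u))^T:=S_{\phi^T(a,\vec f)}(t^T,\vec{u^T})$, $(R_{\phi(a,b,\vec f)}(t,\vec u))^T:=R_{b\in T\land\phi^T(a,b,\vec f)}(t^T,\vec{u^T})$.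 -}

module Defs where

open import Data.Nat using (ℕ; zero; suc; _+_)
open import Data.Fin using (Fin; zero; suc)
open import Data.Vec using (Vec; []; _∷_; tabulate)
open import Data.List using (List; []; _∷_)
open import Data.List.Membership.Propositional using (_∈_)

-- sep φ t us  is  S_{φ(a,f⃗)}(t,u⃗):  φ : Formula (1+k), where inside φ
--   var 0 = a and var (1+i) = f_i.  (The formula φ is part of the symbol
--   and only sees its own variables.)
-- rep φ t us  is  R_{φ(a,b,f⃗)}(t,u⃗): φ : Formula (2+k), where inside φ
--   var 0 = a, var 1 = b and var (2+i) = f_i.

mutual
  data Term (n : ℕ) : Set where
    var  : Fin n → Term n
    ∅    : Term n
    ω    : Term n
    pair : Term n → Term n → Term n
    ⋃    : Term n → Term n
    𝒫    : Term n → Term n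
    sep  : {k : ℕ} → Formula (suc k) → Term n → Vec (Term n) k → Term n
    rep  : {k : ℕ} → Formula (suc (suc k)) → Term n → Vec (Term n) k → Term n

  data Formula (n : ℕ) : Set where
    _∈'_ : Term n → Term n → Formula n
    ⊥'   : Formula n
    _∧'_ : Formula n → Formula n → Formula n
    _∨'_ : Formula n → Formula n → Formula n
    _⇒_  : Formula n → Formula n → Formula n
    all  : Formula (suc n) → Formula n
    ex   : Formula (suc n) → Formula n

infix  6 _∈'_
infixr 5 _∧'_
infixr 4 _∨'_
infixr 3 _⇒_

ext : {n m : ℕ} → (Fin n → Fin m) → Fin (suc n) → Fin (suc m)
ext ρ zero    = zero
ext ρ (suc i) = suc (ρ i)

mutual
  renT : {n m : ℕ} → (Fin n → Fin m) → Term n → Term m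
  renT ρ (var i)      = var (ρ i)
  renT ρ ∅            = ∅
  renT ρ ω            = ω
  renT ρ (pair t u)   = pair (renT ρ t) (renT ρ u)
  renT ρ (⋃ t)        = ⋃ (renT ρ t)
  renT ρ (𝒫 t)        = 𝒫 (renT ρ t)
  renT ρ (sep φ t us) = sep φ (renT ρ t) (renV ρ us)
  renT ρ (rep φ t us) = rep φ (renT ρ t) (renV ρ us)

  renV : {n m k : ℕ} → (Fin n → Fin m) → Vec (Term n) k → Vec (Term m) k
  renV ρ []       = []
  renV ρ (t ∷ ts) = renT ρ t ∷ renV ρ ts

renF : {n m : ℕ} → (Fin n → Fin m) → Formula n → Formula m
renF ρ (t ∈' u) = renT ρ t ∈' renT ρ u
renF ρ ⊥'       = ⊥'
renF ρ (φ ∧' ψ) = renF ρ φ ∧' renF ρ ψ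
renF ρ (φ ∨' ψ) = renF ρ φ ∨' renF ρ ψ
renF ρ (φ ⇒ ψ)  = renF ρ φ ⇒ renF ρ ψ
renF ρ (all φ)  = all (renF (ext ρ) φ)
renF ρ (ex φ)   = ex (renF (ext ρ) φ)

wk : {n : ℕ} → Term n → Term (suc n)
wk = renT suc

wkF : {n : ℕ} → Formula n → Formula (suc n)
wkF = renF suc

exts : {n m : ℕ} → (Fin n → Term m) → Fin (suc n) → Term (suc m)
exts σ zero    = var zero
exts σ (suc i) = wk (σ i)

mutual
  subT : {n m : ℕ} → (Fin n → Term m) → Term n → Term m
  subT σ (var i)      = σ i
  subT σ ∅            = ∅
  subT σ ω            = ω
  subT σ (pair t u)   = pair (subT σ t) (subT σ u)
  subT σ (⋃ t)        = ⋃ (subT σ t)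
  subT σ (𝒫 t)        = 𝒫 (subT σ t)
  subT σ (sep φ t us) = sep φ (subT σ t) (subV σ us)
  subT σ (rep φ t us) = rep φ (subT σ t) (subV σ us)

  subV : {n m k : ℕ} → (Fin n → Term m) → Vec (Term n) k → Vec (Term m) k
  subV σ []       = []
  subV σ (t ∷ ts) = subT σ t ∷ subV σ ts

subF : {n m : ℕ} → (Fin n → Term m) → Formula n → Formula m
subF σ (t ∈' u) = subT σ t ∈' subT σ u
subF σ ⊥'       = ⊥'
subF σ (φ ∧' ψ) = subF σ φ ∧' subF σ ψ
subF σ (φ ∨' ψ) = subF σ φ ∨' subF σ ψ
subF σ (φ ⇒ ψ)  = subF σ φ ⇒ subF σ ψ
subF σ (all φ)  = all (subF (exts σ) φ)
subF σ (ex φ)   = ex (subF (exts σ) φ)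

single : {n : ℕ} → Term n → Fin (suc n) → Term n
single t zero    = t
single t (suc i) = var i

inst : {n : ℕ} → Formula (suc n) → Term n → Formula n
inst φ t = subF (single t) φ

closedF : {n : ℕ} → Formula 0 → Formula n
closedF = renF (λ ())

data _⊢[_]_ (Ax : Formula 0 → Set) : {n : ℕ} → List (Formula n) → Formula n → Set where
  axm  : {n : ℕ} {Γ : List (Formula n)} {χ : Formula 0} → Ax χ → Ax ⊢[ Γ ] closedF χ
  hyp  : {n : ℕ} {Γ : List (Formula n)} {φ : Formula n} → φ ∈ Γ → Ax ⊢[ Γ ] φ
  ⊥E   : {n : ℕ} {Γ : List (Formula n)} {φ : Formula n} → Ax ⊢[ Γ ] ⊥' → Ax ⊢[ Γ ] φ
  ∧I   : {n : ℕ} {Γ : List (Formula n)} {φ ψ : Formula n} →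
         Ax ⊢[ Γ ] φ → Ax ⊢[ Γ ] ψ → Ax ⊢[ Γ ] (φ ∧' ψ)
  ∧E₁  : {n : ℕ} {Γ : List (Formula n)} {φ ψ : Formula n} → Ax ⊢[ Γ ] (φ ∧' ψ) → Ax ⊢[ Γ ] φ
  ∧E₂  : {n : ℕ} {Γ : List (Formula n)} {φ ψ : Formula n} → Ax ⊢[ Γ ] (φ ∧' ψ) → Ax ⊢[ Γ ] ψ
  ∨I₁  : {n : ℕ} {Γ : List (Formula n)} {φ ψ : Formula n} → Ax ⊢[ Γ ] φ → Ax ⊢[ Γ ] (φ ∨' ψ)
  ∨I₂  : {n : ℕ} {Γ : List (Formula n)} {φ ψ : Formula n} → Ax ⊢[ Γ ] ψ → Ax ⊢[ Γ ] (φ ∨' ψ)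
  ∨E   : {n : ℕ} {Γ : List (Formula n)} {φ ψ θ : Formula n} →
         Ax ⊢[ Γ ] (φ ∨' ψ) → Ax ⊢[ φ ∷ Γ ] θ → Ax ⊢[ ψ ∷ Γ ] θ → Ax ⊢[ Γ ] θ
  ⇒I   : {n : ℕ} {Γ : List (Formula n)} {φ ψ : Formula n} → Ax ⊢[ φ ∷ Γ ] ψ → Ax ⊢[ Γ ] (φ ⇒ ψ)
  ⇒E   : {n : ℕ} {Γ : List (Formula n)} {φ ψ : Formula n} →
         Ax ⊢[ Γ ] (φ ⇒ ψ) → Ax ⊢[ Γ ] φ → Ax ⊢[ Γ ] ψ
  ∀I   : {n : ℕ} {Γ : List (Formula n)} {φ : Formula (suc n)} →
         Ax ⊢[ Data.List.map wkF Γ ] φ → Ax ⊢[ Γ ] all φ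
  ∀E   : {n : ℕ} {Γ : List (Formula n)} {φ : Formula (suc n)} →
         Ax ⊢[ Γ ] all φ → (t : Term n) → Ax ⊢[ Γ ] inst φ t
  ∃I   : {n : ℕ} {Γ : List (Formula n)} {φ : Formula (suc n)} →
         (t : Term n) → Ax ⊢[ Γ ] inst φ t → Ax ⊢[ Γ ] ex φ
  ∃E   : {n : ℕ} {Γ : List (Formula n)} {φ : Formula (suc n)} {ψ : Formula n} →
         Ax ⊢[ Γ ] ex φ → Ax ⊢[ φ ∷ Data.List.map wkF Γ ] wkF ψ → Ax ⊢[ Γ ] ψ

v0 : {n : ℕ} → Term (suc n)
v0 = var zero
v1 : {n : ℕ} → Term (suc (suc n))
v1 = var (suc zero)
v2 : {n : ℕ} → Term (suc (suc (suc n)))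
v2 = var (suc (suc zero))

_⇔_ : {n : ℕ} → Formula n → Formula n → Formula n
φ ⇔ ψ = (φ ⇒ ψ) ∧' (ψ ⇒ φ)
infix 2 _⇔_

_≐_ : {n : ℕ} → Term n → Term n → Formula n
t ≐ u = all ((v0 ∈' wk t) ⇔ (v0 ∈' wk u))
infix 6 _≐_

Succ : {n : ℕ} → Term n → Term n
Succ t = ⋃ (pair t (pair t t))

allIn : {n : ℕ} → Term n → Formula (suc n) → Formula n
allIn t φ = all ((v0 ∈' wk t) ⇒ φ)

exIn : {n : ℕ} → Term n → Formula (suc n) → Formula n
exIn t φ = ex ((v0 ∈' wk t) ∧' φ)

shift2 : {n : ℕ} → Fin (suc n) → Fin (suc (suc n))
shift2 zero    = zero
shift2 (suc i) = suc (suc i)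

ex! : {n : ℕ} → Formula (suc n) → Formula n
ex! φ = ex (φ ∧' all (renF shift2 φ ⇒ (v0 ≐ v1)))

allN : (k : ℕ) → Formula k → Formula 0
allN zero    φ = φ
allN (suc k) φ = allN k (all φ)

-- Axioms of IZF_R.  Inside the body of a schema instance, with the
-- universally closed variables f⃗ (k of them), then a, then c (or b):
-- var 0 = c, var 1 = a, var (2+i) = f_i.

fs2 : {k : ℕ} → Vec (Term (suc (suc k))) k
fs2 = tabulate (λ i → var (suc (suc i)))

-- SEP: φ(c,f⃗): var 0 ↦ c = var 0, var (1+i) ↦ f_i = var (2+i)
sepRen : {k : ℕ} → Fin (suc k) → Fin (suc (suc k))
sepRen zero    = zero
sepRen (suc i) = suc (suc i)

SEPax : (k : ℕ) → Formula (suc k) → Formula 0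
SEPax k φ = allN k (all (all
  ((v0 ∈' sep φ v1 fs2) ⇔ ((v0 ∈' v1) ∧' renF sepRen φ))))

-- REPL: scope inside ∀x∈a ∃!y:  y=0, x=1, c=2, a=3, f_i = 4+i
replRen1 : {k : ℕ} → Fin (suc (suc k)) → Fin (suc (suc (suc (suc k))))
replRen1 zero          = suc zero
replRen1 (suc zero)    = zero
replRen1 (suc (suc i)) = suc (suc (suc (suc i)))

-- scope inside ∃x∈a:  x=0, c=1, a=2, f_i = 3+i
replRen2 : {k : ℕ} → Fin (suc (suc k)) → Fin (suc (suc (suc k)))
replRen2 zero          = zero
replRen2 (suc zero)    = suc zero
replRen2 (suc (suc i)) = suc (suc (suc i))

REPLax : (k : ℕ) → Formula (suc (suc k)) → Formula 0
REPLax k φ = allN k (all (all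
  ((v0 ∈' rep φ v1 fs2) ⇔
     (allIn v1 (ex! (renF replRen1 φ)) ∧' exIn v1 (renF replRen2 φ)))))

-- IND: at scope k, f_i = var i
indRen : {k : ℕ} → Fin (suc k) → Fin (suc (suc k))
indRen zero    = zero
indRen (suc i) = suc (suc i)

INDax : (k : ℕ) → Formula (suc k) → Formula 0
INDax k φ = allN k
  ((all (allIn v0 (renF indRen φ) ⇒ φ)) ⇒ all φ)

-- L: scope inside: b = 0, a = 1, f_i = 2+i
leibRenA : {k : ℕ} → Fin (suc k) → Fin (suc (suc k))
leibRenA zero    = suc zero
leibRenA (suc i) = suc (suc i)

leibRenB : {k : ℕ} → Fin (suc k) → Fin (suc (suc k))
leibRenB zero    = zero
leibRenB (suc i) = suc (suc i)

Lax : (k : ℕ) → Formula (suc k) → Formula 0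
Lax k φ = allN k (all (all
  ((v1 ≐ v0) ⇒ (renF leibRenA φ ⇒ renF leibRenB φ))))

EMPTYax : Formula 0
EMPTYax = all ((v0 ∈' ∅) ⇔ ⊥')

-- ∀a ∀b ∀c:  c = 0, b = 1, a = 2
PAIRax : Formula 0
PAIRax = all (all (all ((v0 ∈' pair v2 v1) ⇔ ((v0 ≐ v2) ∨' (v0 ≐ v1)))))

-- inside ∃b∈ω: b = 0, c = 1
INFax : Formula 0
INFax = all ((v0 ∈' ω) ⇔ ((v0 ≐ ∅) ∨' exIn ω (v1 ≐ Succ v0)))

-- ∀a ∀c: c = 0, a = 1; inside ∃b∈a: b = 0, c = 1, a = 2
UNIONax : Formula 0
UNIONax = all (all ((v0 ∈' ⋃ v1) ⇔ exIn v1 (v1 ∈' v0)))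

-- inside ∀b: b = 0, c = 1, a = 2
POWERax : Formula 0
POWERax = all (all ((v0 ∈' 𝒫 v1) ⇔ all ((v0 ∈' v1) ⇒ (v0 ∈' v2))))

data AxIZF⁻ : Formula 0 → Set where
  EMPTY : AxIZF⁻ EMPTYax
  PAIR  : AxIZF⁻ PAIRax
  INF   : AxIZF⁻ INFax
  UNION : AxIZF⁻ UNIONax
  POWER : AxIZF⁻ POWERax
  SEP   : (k : ℕ) (φ : Formula (suc k)) → AxIZF⁻ (SEPax k φ)
  REPL  : (k : ℕ) (φ : Formula (suc (suc k))) → AxIZF⁻ (REPLax k φ)
  IND   : (k : ℕ) (φ : Formula (suc k)) → AxIZF⁻ (INDax k φ)

data AxIZF : Formula 0 → Set where
  base : {χ : Formula 0} → AxIZF⁻ χ → AxIZF χ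
  L    : (k : ℕ) (φ : Formula (suc k)) → AxIZF (Lax k φ)

wk2 : {n : ℕ} → Term n → Term (suc (suc n))
wk2 t = wk (wk t)

-- C is L-stable: ∀A ∀B. A ∈ C ∧ A = B → B ∈ C     (A = 1, B = 0)
LStable : {n : ℕ} → Term n → Formula n
LStable C = all (all (((v1 ∈' wk2 C) ∧' (v1 ≐ v0)) ⇒ (v0 ∈' wk2 C)))

Subset : {n : ℕ} → Term n → Term n → Formula n
Subset s t = all ((v0 ∈' wk s) ⇒ (v0 ∈' wk t))

Transitive : {n : ℕ} → Term n → Formula n
Transitive D = allIn D (allIn v0 (v0 ∈' wk2 D))

-- x ∈ TC({C}): x lies in every transitive set D with {C} ⊆ D
-- (TC({C}) is the least transitive superset of {C}).
InTC : {n : ℕ} → Term n → Term n → Formula n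
InTC x C = all ((Subset (pair (wk C) (wk C)) v0 ∧' Transitive v0) ⇒ (wk x ∈' v0))

TLS : {n : ℕ} → Term n → Formula n
TLS C = all (InTC v0 (wk C) ⇒ LStable v0)

-- Relativization to T = {C | TLS(C)}

mutual
  relT : {n : ℕ} → Term n → Term n
  relT (var i)      = var i
  relT ∅            = ∅
  relT ω            = ω
  relT (pair t u)   = pair (relT t) (relT u)
  relT (⋃ t)        = ⋃ (relT t)
  relT (𝒫 t)        = sep {k = 0} (TLS v0) (𝒫 (relT t)) []
  relT (sep φ t us) = sep (relF φ) (relT t) (relV us)
  relT (rep φ t us) = rep ((TLS v1) ∧' relF φ) (relT t) (relV us)

  relV : {n k : ℕ} → Vec (Term n) k → Vec (Term n) k
  relV []       = []
  relV (t ∷ ts) = relT t ∷ relV ts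

  relF : {n : ℕ} → Formula n → Formula n
  relF (t ∈' u) = relT t ∈' relT u
  relF ⊥'       = ⊥'
  relF (φ ∧' ψ) = relF φ ∧' relF ψ
  relF (φ ∨' ψ) = relF φ ∨' relF ψ
  relF (φ ⇒ ψ)  = relF φ ⇒ relF ψ
  relF (all φ)  = all (TLS v0 ⇒ relF φ)
  relF (ex φ)   = ex (TLS v0 ∧' relF φ)

-- Apart from Leibniz, every relativized axiom is essentially an instance of the same axiom
-- of IZF_R⁻: Separation and Replacement for φᵀ (resp. TLS(b) ∧ φᵀ), Induction for
-- TLS(a) → φᵀ, and Power with 𝒫ᵀ(a) = {x ∈ 𝒫(a) | TLS(x)}. What makes the translation
-- work is that T is closed under elements and under =, so that on members of T the
-- relativized equality ∀z∈T (z∈a ↔ z∈b) coincides with a = b.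
--
-- The Leibniz schema is proved by induction on φ: for a = b in T, φᵀ(a) → φᵀ(b),
-- simultaneously with the congruence of relativized terms. The atomic case t ∈ s needs
-- the value of sᵀ to be L-stable, and since separation and replacement terms carry
-- formulas, also elements of values of terms up to a depth bounded by their syntax. Rather
-- than showing that these values lie in T (which would involve transitive closures), we
-- only track the finite approximations Lev k of transitive L-stability, bounding the
-- depth needed by the syntactic measures depth/depthF.

module Submission where

open import Defs
open import Data.Nat using (ℕ; zero; suc; _+_; _≤_; z≤n; s≤s)
open import Data.Nat.Properties
  using (≤-trans; ≤-reflexive; +-suc; m≤m+n; m≤n+m; n≤1+n; m≤n⇒m≤n+o; +-mono-≤; +-monoˡ-≤)
open import Data.Fin using (Fin; zero; suc)
open import Data.Vec using (Vec; []; _∷_; tabulate; lookup)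
open import Data.Vec.Properties using (tabulate∘lookup)
open import Data.List using (List; []; _∷_; map)
open import Data.List.Properties using (map-cong; map-∘)
open import Data.List.Membership.Propositional.Properties using (∈-map⁺)
open import Data.List.Relation.Binary.Subset.Propositional using (_⊆_)
open import Data.List.Relation.Binary.Subset.Propositional.Properties using (map⁺; ∷⁺ʳ)
open import Data.List.Relation.Unary.Any using (here; there)
open import Relation.Binary.PropositionalEquality
open import Function using (_∘_)

private variable
  n m p k : ℕ
  Ax : Formula 0 → Set
  Γ : List (Formula n)

cong₄ : {A B C D E : Set} (f : A → B → C → D → E) {a a' : A} {b b' : B} {c c' : C} {d d' : D} →
        a ≡ a' → b ≡ b' → c ≡ c' → d ≡ d' → f a b c d ≡ f a' b' c' d'
cong₄ f refl refl refl refl = refl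

ext-cong : {ρ ρ' : Fin n → Fin m} → ρ ≗ ρ' → ext ρ ≗ ext ρ'
ext-cong e zero = refl
ext-cong e (suc i) = cong suc (e i)

mutual
  renT-cong : {ρ ρ' : Fin n → Fin m} → ρ ≗ ρ' → (t : Term n) → renT ρ t ≡ renT ρ' t
  renT-cong e (var i) = cong var (e i)
  renT-cong e ∅ = refl
  renT-cong e ω = refl
  renT-cong e (pair t u) = cong₂ pair (renT-cong e t) (renT-cong e u)
  renT-cong e (⋃ t) = cong ⋃ (renT-cong e t)
  renT-cong e (𝒫 t) = cong 𝒫 (renT-cong e t)
  renT-cong e (sep φ t us) = cong₂ (sep φ) (renT-cong e t) (renV-cong e us)
  renT-cong e (rep φ t us) = cong₂ (rep φ) (renT-cong e t) (renV-cong e us)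

  renV-cong : {ρ ρ' : Fin n → Fin m} → ρ ≗ ρ' → (ts : Vec (Term n) k) → renV ρ ts ≡ renV ρ' ts
  renV-cong e [] = refl
  renV-cong e (t ∷ ts) = cong₂ _∷_ (renT-cong e t) (renV-cong e ts)

renF-cong : {ρ ρ' : Fin n → Fin m} → ρ ≗ ρ' → (φ : Formula n) → renF ρ φ ≡ renF ρ' φ
renF-cong e (t ∈' u) = cong₂ _∈'_ (renT-cong e t) (renT-cong e u)
renF-cong e ⊥' = refl
renF-cong e (φ ∧' ψ) = cong₂ _∧'_ (renF-cong e φ) (renF-cong e ψ)
renF-cong e (φ ∨' ψ) = cong₂ _∨'_ (renF-cong e φ) (renF-cong e ψ)
renF-cong e (φ ⇒ ψ) = cong₂ _⇒_ (renF-cong e φ) (renF-cong e ψ)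
renF-cong e (all φ) = cong all (renF-cong (ext-cong e) φ)
renF-cong e (ex φ) = cong ex (renF-cong (ext-cong e) φ)

exts-cong : {σ σ' : Fin n → Term m} → σ ≗ σ' → exts σ ≗ exts σ'
exts-cong e zero = refl
exts-cong e (suc i) = cong wk (e i)

mutual
  subT-cong : {σ σ' : Fin n → Term m} → σ ≗ σ' → (t : Term n) → subT σ t ≡ subT σ' t
  subT-cong e (var i) = e i
  subT-cong e ∅ = refl
  subT-cong e ω = refl
  subT-cong e (pair t u) = cong₂ pair (subT-cong e t) (subT-cong e u)
  subT-cong e (⋃ t) = cong ⋃ (subT-cong e t)
  subT-cong e (𝒫 t) = cong 𝒫 (subT-cong e t)
  subT-cong e (sep φ t us) = cong₂ (sep φ) (subT-cong e t) (subV-cong e us)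
  subT-cong e (rep φ t us) = cong₂ (rep φ) (subT-cong e t) (subV-cong e us)

  subV-cong : {σ σ' : Fin n → Term m} → σ ≗ σ' → (ts : Vec (Term n) k) → subV σ ts ≡ subV σ' ts
  subV-cong e [] = refl
  subV-cong e (t ∷ ts) = cong₂ _∷_ (subT-cong e t) (subV-cong e ts)

subF-cong : {σ σ' : Fin n → Term m} → σ ≗ σ' → (φ : Formula n) → subF σ φ ≡ subF σ' φ
subF-cong e (t ∈' u) = cong₂ _∈'_ (subT-cong e t) (subT-cong e u)
subF-cong e ⊥' = refl
subF-cong e (φ ∧' ψ) = cong₂ _∧'_ (subF-cong e φ) (subF-cong e ψ)
subF-cong e (φ ∨' ψ) = cong₂ _∨'_ (subF-cong e φ) (subF-cong e ψ)
subF-cong e (φ ⇒ ψ) = cong₂ _⇒_ (subF-cong e φ) (subF-cong e ψ)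
subF-cong e (all φ) = cong all (subF-cong (exts-cong e) φ)
subF-cong e (ex φ) = cong ex (subF-cong (exts-cong e) φ)

mutual
  renT-sub : (ρ : Fin n → Fin m) (t : Term n) → renT ρ t ≡ subT (var ∘ ρ) t
  renT-sub ρ (var i) = refl
  renT-sub ρ ∅ = refl
  renT-sub ρ ω = refl
  renT-sub ρ (pair t u) = cong₂ pair (renT-sub ρ t) (renT-sub ρ u)
  renT-sub ρ (⋃ t) = cong ⋃ (renT-sub ρ t)
  renT-sub ρ (𝒫 t) = cong 𝒫 (renT-sub ρ t)
  renT-sub ρ (sep φ t us) = cong₂ (sep φ) (renT-sub ρ t) (renV-sub ρ us)
  renT-sub ρ (rep φ t us) = cong₂ (rep φ) (renT-sub ρ t) (renV-sub ρ us)

  renV-sub : (ρ : Fin n → Fin m) (ts : Vec (Term n) k) → renV ρ ts ≡ subV (var ∘ ρ) ts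
  renV-sub ρ [] = refl
  renV-sub ρ (t ∷ ts) = cong₂ _∷_ (renT-sub ρ t) (renV-sub ρ ts)

ext-exts : (ρ : Fin n → Fin m) → var ∘ ext ρ ≗ exts (var ∘ ρ)
ext-exts ρ zero = refl
ext-exts ρ (suc i) = refl

renF-sub : (ρ : Fin n → Fin m) (φ : Formula n) → renF ρ φ ≡ subF (var ∘ ρ) φ
renF-sub ρ (t ∈' u) = cong₂ _∈'_ (renT-sub ρ t) (renT-sub ρ u)
renF-sub ρ ⊥' = refl
renF-sub ρ (φ ∧' ψ) = cong₂ _∧'_ (renF-sub ρ φ) (renF-sub ρ ψ)
renF-sub ρ (φ ∨' ψ) = cong₂ _∨'_ (renF-sub ρ φ) (renF-sub ρ ψ)
renF-sub ρ (φ ⇒ ψ) = cong₂ _⇒_ (renF-sub ρ φ) (renF-sub ρ ψ)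
renF-sub ρ (all φ) = cong all (trans (renF-sub (ext ρ) φ) (subF-cong (ext-exts ρ) φ))
renF-sub ρ (ex φ) = cong ex (trans (renF-sub (ext ρ) φ) (subF-cong (ext-exts ρ) φ))

mutual
  subT-renT : (σ : Fin m → Term p) (ρ : Fin n → Fin m) (t : Term n) → subT σ (renT ρ t) ≡ subT (σ ∘ ρ) t
  subT-renT σ ρ (var i) = refl
  subT-renT σ ρ ∅ = refl
  subT-renT σ ρ ω = refl
  subT-renT σ ρ (pair t u) = cong₂ pair (subT-renT σ ρ t) (subT-renT σ ρ u)
  subT-renT σ ρ (⋃ t) = cong ⋃ (subT-renT σ ρ t)
  subT-renT σ ρ (𝒫 t) = cong 𝒫 (subT-renT σ ρ t)
  subT-renT σ ρ (sep φ t us) = cong₂ (sep φ) (subT-renT σ ρ t) (subV-renV σ ρ us)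
  subT-renT σ ρ (rep φ t us) = cong₂ (rep φ) (subT-renT σ ρ t) (subV-renV σ ρ us)

  subV-renV : (σ : Fin m → Term p) (ρ : Fin n → Fin m) (ts : Vec (Term n) k) → subV σ (renV ρ ts) ≡ subV (σ ∘ ρ) ts
  subV-renV σ ρ [] = refl
  subV-renV σ ρ (t ∷ ts) = cong₂ _∷_ (subT-renT σ ρ t) (subV-renV σ ρ ts)

exts-ext : (σ : Fin m → Term p) (ρ : Fin n → Fin m) → exts σ ∘ ext ρ ≗ exts (σ ∘ ρ)
exts-ext σ ρ zero = refl
exts-ext σ ρ (suc i) = refl

subF-renF : (σ : Fin m → Term p) (ρ : Fin n → Fin m) (φ : Formula n) → subF σ (renF ρ φ) ≡ subF (σ ∘ ρ) φ
subF-renF σ ρ (t ∈' u) = cong₂ _∈'_ (subT-renT σ ρ t) (subT-renT σ ρ u)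
subF-renF σ ρ ⊥' = refl
subF-renF σ ρ (φ ∧' ψ) = cong₂ _∧'_ (subF-renF σ ρ φ) (subF-renF σ ρ ψ)
subF-renF σ ρ (φ ∨' ψ) = cong₂ _∨'_ (subF-renF σ ρ φ) (subF-renF σ ρ ψ)
subF-renF σ ρ (φ ⇒ ψ) = cong₂ _⇒_ (subF-renF σ ρ φ) (subF-renF σ ρ ψ)
subF-renF σ ρ (all φ) = cong all (trans (subF-renF (exts σ) (ext ρ) φ) (subF-cong (exts-ext σ ρ) φ))
subF-renF σ ρ (ex φ) = cong ex (trans (subF-renF (exts σ) (ext ρ) φ) (subF-cong (exts-ext σ ρ) φ))

renT-renT : (ρ : Fin m → Fin p) (ρ' : Fin n → Fin m) (t : Term n) → renT ρ (renT ρ' t) ≡ renT (ρ ∘ ρ') t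
renT-renT ρ ρ' t = trans (renT-sub ρ (renT ρ' t)) (trans (subT-renT (var ∘ ρ) ρ' t) (sym (renT-sub (ρ ∘ ρ') t)))

renF-renF : (ρ : Fin m → Fin p) (ρ' : Fin n → Fin m) (φ : Formula n) → renF ρ (renF ρ' φ) ≡ renF (ρ ∘ ρ') φ
renF-renF ρ ρ' φ = trans (renF-sub ρ (renF ρ' φ)) (trans (subF-renF (var ∘ ρ) ρ' φ) (sym (renF-sub (ρ ∘ ρ') φ)))

mutual
  renT-subT : (ρ : Fin m → Fin p) (σ : Fin n → Term m) (t : Term n) → renT ρ (subT σ t) ≡ subT (renT ρ ∘ σ) t
  renT-subT ρ σ (var i) = refl
  renT-subT ρ σ ∅ = refl
  renT-subT ρ σ ω = refl
  renT-subT ρ σ (pair t u) = cong₂ pair (renT-subT ρ σ t) (renT-subT ρ σ u)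
  renT-subT ρ σ (⋃ t) = cong ⋃ (renT-subT ρ σ t)
  renT-subT ρ σ (𝒫 t) = cong 𝒫 (renT-subT ρ σ t)
  renT-subT ρ σ (sep φ t us) = cong₂ (sep φ) (renT-subT ρ σ t) (renV-subV ρ σ us)
  renT-subT ρ σ (rep φ t us) = cong₂ (rep φ) (renT-subT ρ σ t) (renV-subV ρ σ us)

  renV-subV : (ρ : Fin m → Fin p) (σ : Fin n → Term m) (ts : Vec (Term n) k) → renV ρ (subV σ ts) ≡ subV (renT ρ ∘ σ) ts
  renV-subV ρ σ [] = refl
  renV-subV ρ σ (t ∷ ts) = cong₂ _∷_ (renT-subT ρ σ t) (renV-subV ρ σ ts)

renT-exts : (ρ : Fin m → Fin p) (σ : Fin n → Term m) → renT (ext ρ) ∘ exts σ ≗ exts (renT ρ ∘ σ)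
renT-exts ρ σ zero = refl
renT-exts ρ σ (suc i) = trans (renT-renT (ext ρ) suc (σ i)) (sym (renT-renT suc ρ (σ i)))

renF-subF : (ρ : Fin m → Fin p) (σ : Fin n → Term m) (φ : Formula n) → renF ρ (subF σ φ) ≡ subF (renT ρ ∘ σ) φ
renF-subF ρ σ (t ∈' u) = cong₂ _∈'_ (renT-subT ρ σ t) (renT-subT ρ σ u)
renF-subF ρ σ ⊥' = refl
renF-subF ρ σ (φ ∧' ψ) = cong₂ _∧'_ (renF-subF ρ σ φ) (renF-subF ρ σ ψ)
renF-subF ρ σ (φ ∨' ψ) = cong₂ _∨'_ (renF-subF ρ σ φ) (renF-subF ρ σ ψ)
renF-subF ρ σ (φ ⇒ ψ) = cong₂ _⇒_ (renF-subF ρ σ φ) (renF-subF ρ σ ψ)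
renF-subF ρ σ (all φ) = cong all (trans (renF-subF (ext ρ) (exts σ) φ) (subF-cong (renT-exts ρ σ) φ))
renF-subF ρ σ (ex φ) = cong ex (trans (renF-subF (ext ρ) (exts σ) φ) (subF-cong (renT-exts ρ σ) φ))

mutual
  subT-subT : (σ : Fin m → Term p) (τ : Fin n → Term m) (t : Term n) → subT σ (subT τ t) ≡ subT (subT σ ∘ τ) t
  subT-subT σ τ (var i) = refl
  subT-subT σ τ ∅ = refl
  subT-subT σ τ ω = refl
  subT-subT σ τ (pair t u) = cong₂ pair (subT-subT σ τ t) (subT-subT σ τ u)
  subT-subT σ τ (⋃ t) = cong ⋃ (subT-subT σ τ t)
  subT-subT σ τ (𝒫 t) = cong 𝒫 (subT-subT σ τ t)
  subT-subT σ τ (sep φ t us) = cong₂ (sep φ) (subT-subT σ τ t) (subV-subV σ τ us)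
  subT-subT σ τ (rep φ t us) = cong₂ (rep φ) (subT-subT σ τ t) (subV-subV σ τ us)

  subV-subV : (σ : Fin m → Term p) (τ : Fin n → Term m) (ts : Vec (Term n) k) → subV σ (subV τ ts) ≡ subV (subT σ ∘ τ) ts
  subV-subV σ τ [] = refl
  subV-subV σ τ (t ∷ ts) = cong₂ _∷_ (subT-subT σ τ t) (subV-subV σ τ ts)

subT-wk : (σ : Fin n → Term m) (t : Term n) → subT (exts σ) (wk t) ≡ wk (subT σ t)
subT-wk σ t = trans (subT-renT (exts σ) suc t) (sym (renT-subT suc σ t))

subT-wk2 : (σ : Fin n → Term m) (t : Term n) → subT (exts (exts σ)) (wk2 t) ≡ wk2 (subT σ t)
subT-wk2 σ t = trans (subT-wk (exts σ) (wk t)) (cong wk (subT-wk σ t))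

exts-exts : (σ : Fin m → Term p) (τ : Fin n → Term m) → subT (exts σ) ∘ exts τ ≗ exts (subT σ ∘ τ)
exts-exts σ τ zero = refl
exts-exts σ τ (suc i) = subT-wk σ (τ i)

subF-subF : (σ : Fin m → Term p) (τ : Fin n → Term m) (φ : Formula n) → subF σ (subF τ φ) ≡ subF (subT σ ∘ τ) φ
subF-subF σ τ (t ∈' u) = cong₂ _∈'_ (subT-subT σ τ t) (subT-subT σ τ u)
subF-subF σ τ ⊥' = refl
subF-subF σ τ (φ ∧' ψ) = cong₂ _∧'_ (subF-subF σ τ φ) (subF-subF σ τ ψ)
subF-subF σ τ (φ ∨' ψ) = cong₂ _∨'_ (subF-subF σ τ φ) (subF-subF σ τ ψ)
subF-subF σ τ (φ ⇒ ψ) = cong₂ _⇒_ (subF-subF σ τ φ) (subF-subF σ τ ψ)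
subF-subF σ τ (all φ) = cong all (trans (subF-subF (exts σ) (exts τ) φ) (subF-cong (exts-exts σ τ) φ))
subF-subF σ τ (ex φ) = cong ex (trans (subF-subF (exts σ) (exts τ) φ) (subF-cong (exts-exts σ τ) φ))

exts-var : exts {n} var ≗ var
exts-var zero = refl
exts-var (suc i) = refl

mutual
  subT-id : (t : Term n) → subT var t ≡ t
  subT-id (var i) = refl
  subT-id ∅ = refl
  subT-id ω = refl
  subT-id (pair t u) = cong₂ pair (subT-id t) (subT-id u)
  subT-id (⋃ t) = cong ⋃ (subT-id t)
  subT-id (𝒫 t) = cong 𝒫 (subT-id t)
  subT-id (sep φ t us) = cong₂ (sep φ) (subT-id t) (subV-id us)
  subT-id (rep φ t us) = cong₂ (rep φ) (subT-id t) (subV-id us)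

  subV-id : (ts : Vec (Term n) k) → subV var ts ≡ ts
  subV-id [] = refl
  subV-id (t ∷ ts) = cong₂ _∷_ (subT-id t) (subV-id ts)

subF-id : (φ : Formula n) → subF var φ ≡ φ
subF-id (t ∈' u) = cong₂ _∈'_ (subT-id t) (subT-id u)
subF-id ⊥' = refl
subF-id (φ ∧' ψ) = cong₂ _∧'_ (subF-id φ) (subF-id ψ)
subF-id (φ ∨' ψ) = cong₂ _∨'_ (subF-id φ) (subF-id ψ)
subF-id (φ ⇒ ψ) = cong₂ _⇒_ (subF-id φ) (subF-id ψ)
subF-id (all φ) = cong all (trans (subF-cong exts-var φ) (subF-id φ))
subF-id (ex φ) = cong ex (trans (subF-cong exts-var φ) (subF-id φ))

subT-single-wk : (s : Term n) (t : Term n) → subT (single s) (wk t) ≡ t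
subT-single-wk s t = trans (subT-renT (single s) suc t) (subT-id t)

mutual
  relT-ren : (ρ : Fin n → Fin m) (t : Term n) → relT (renT ρ t) ≡ renT ρ (relT t)
  relT-ren ρ (var i) = refl
  relT-ren ρ ∅ = refl
  relT-ren ρ ω = refl
  relT-ren ρ (pair t u) = cong₂ pair (relT-ren ρ t) (relT-ren ρ u)
  relT-ren ρ (⋃ t) = cong ⋃ (relT-ren ρ t)
  relT-ren ρ (𝒫 t) = cong (λ x → sep (TLS v0) (𝒫 x) []) (relT-ren ρ t)
  relT-ren ρ (sep φ t us) = cong₂ (sep (relF φ)) (relT-ren ρ t) (relV-ren ρ us)
  relT-ren ρ (rep φ t us) = cong₂ (rep (TLS v1 ∧' relF φ)) (relT-ren ρ t) (relV-ren ρ us)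

  relV-ren : (ρ : Fin n → Fin m) (ts : Vec (Term n) k) → relV (renV ρ ts) ≡ renV ρ (relV ts)
  relV-ren ρ [] = refl
  relV-ren ρ (t ∷ ts) = cong₂ _∷_ (relT-ren ρ t) (relV-ren ρ ts)

relF-ren : (ρ : Fin n → Fin m) (φ : Formula n) → relF (renF ρ φ) ≡ renF ρ (relF φ)
relF-ren ρ (t ∈' u) = cong₂ _∈'_ (relT-ren ρ t) (relT-ren ρ u)
relF-ren ρ ⊥' = refl
relF-ren ρ (φ ∧' ψ) = cong₂ _∧'_ (relF-ren ρ φ) (relF-ren ρ ψ)
relF-ren ρ (φ ∨' ψ) = cong₂ _∨'_ (relF-ren ρ φ) (relF-ren ρ ψ)
relF-ren ρ (φ ⇒ ψ) = cong₂ _⇒_ (relF-ren ρ φ) (relF-ren ρ ψ)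
relF-ren ρ (all φ) = cong (λ x → all (TLS v0 ⇒ x)) (relF-ren (ext ρ) φ)
relF-ren ρ (ex φ) = cong (λ x → ex (TLS v0 ∧' x)) (relF-ren (ext ρ) φ)

relV-tabulate-var : (f : Fin k → Fin m) → relV (tabulate (var ∘ f)) ≡ tabulate (var ∘ f)
relV-tabulate-var {k = zero} f = refl
relV-tabulate-var {k = suc k} f = cong (var (f zero) ∷_) (relV-tabulate-var (f ∘ suc))

relV-fs2 : relV (fs2 {k}) ≡ fs2
relV-fs2 = relV-tabulate-var (λ i → suc (suc i))

infix 1 _⊢_
_⊢_ : List (Formula n) → Formula n → Set
Γ ⊢ φ = AxIZF⁻ ⊢[ Γ ] φ

weaken : {Γ Δ : List (Formula n)} {φ : Formula n} → Γ ⊆ Δ → Ax ⊢[ Γ ] φ → Ax ⊢[ Δ ] φ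
weaken s (axm a) = axm a
weaken s (hyp h) = hyp (s h)
weaken s (⊥E d) = ⊥E (weaken s d)
weaken s (∧I d e) = ∧I (weaken s d) (weaken s e)
weaken s (∧E₁ d) = ∧E₁ (weaken s d)
weaken s (∧E₂ d) = ∧E₂ (weaken s d)
weaken s (∨I₁ d) = ∨I₁ (weaken s d)
weaken s (∨I₂ d) = ∨I₂ (weaken s d)
weaken s (∨E d e f) = ∨E (weaken s d) (weaken (∷⁺ʳ _ s) e) (weaken (∷⁺ʳ _ s) f)
weaken s (⇒I d) = ⇒I (weaken (∷⁺ʳ _ s) d)
weaken s (⇒E d e) = ⇒E (weaken s d) (weaken s e)
weaken s (∀I d) = ∀I (weaken (map⁺ wkF s) d)
weaken s (∀E d t) = ∀E (weaken s d) t
weaken s (∃I t d) = ∃I t (weaken s d)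
weaken s (∃E d e) = ∃E (weaken s d) (weaken (∷⁺ʳ _ (map⁺ wkF s)) e)

cast : {φ ψ : Formula n} → φ ≡ ψ → Ax ⊢[ Γ ] φ → Ax ⊢[ Γ ] ψ
cast refl d = d

castCtx : {Γ Δ : List (Formula n)} {φ : Formula n} → Γ ≡ Δ → Ax ⊢[ Γ ] φ → Ax ⊢[ Δ ] φ
castCtx refl d = d

closedF-ren : (ρ : Fin n → Fin m) (χ : Formula 0) → renF ρ (closedF {n} χ) ≡ closedF χ
closedF-ren ρ χ = trans (renF-renF ρ (λ ()) χ) (renF-cong (λ ()) χ)

inst-ren : (ρ : Fin n → Fin m) (φ : Formula (suc n)) (t : Term n) →
           renF ρ (inst φ t) ≡ inst (renF (ext ρ) φ) (renT ρ t)
inst-ren ρ φ t = trans (renF-subF ρ (single t) φ)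
  (trans (subF-cong e φ) (sym (subF-renF (single (renT ρ t)) (ext ρ) φ)))
  where
  e : renT ρ ∘ single t ≗ single (renT ρ t) ∘ ext ρ
  e zero = refl
  e (suc i) = refl

renF-ext-wkF : (ρ : Fin n → Fin m) (ψ : Formula n) → renF (ext ρ) (wkF ψ) ≡ wkF (renF ρ ψ)
renF-ext-wkF ρ ψ = trans (renF-renF (ext ρ) suc ψ) (sym (renF-renF suc ρ ψ))

map-renF-ext-wkF : (ρ : Fin n → Fin m) (Γ : List (Formula n)) →
                   map (renF (ext ρ)) (map wkF Γ) ≡ map wkF (map (renF ρ) Γ)
map-renF-ext-wkF ρ Γ = trans (sym (map-∘ Γ)) (trans (map-cong (renF-ext-wkF ρ) Γ) (map-∘ Γ))

ren⊢ : (ρ : Fin n → Fin m) {Γ : List (Formula n)} {φ : Formula n} → Ax ⊢[ Γ ] φ → Ax ⊢[ map (renF ρ) Γ ] renF ρ φ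
ren⊢ ρ (axm {χ = χ} a) = cast (sym (closedF-ren ρ χ)) (axm a)
ren⊢ ρ (hyp h) = hyp (∈-map⁺ (renF ρ) h)
ren⊢ ρ (⊥E d) = ⊥E (ren⊢ ρ d)
ren⊢ ρ (∧I d e) = ∧I (ren⊢ ρ d) (ren⊢ ρ e)
ren⊢ ρ (∧E₁ d) = ∧E₁ (ren⊢ ρ d)
ren⊢ ρ (∧E₂ d) = ∧E₂ (ren⊢ ρ d)
ren⊢ ρ (∨I₁ d) = ∨I₁ (ren⊢ ρ d)
ren⊢ ρ (∨I₂ d) = ∨I₂ (ren⊢ ρ d)
ren⊢ ρ (∨E d e f) = ∨E (ren⊢ ρ d) (ren⊢ ρ e) (ren⊢ ρ f)
ren⊢ ρ (⇒I d) = ⇒I (ren⊢ ρ d)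
ren⊢ ρ (⇒E d e) = ⇒E (ren⊢ ρ d) (ren⊢ ρ e)
ren⊢ ρ {Γ} (∀I d) = ∀I (castCtx (map-renF-ext-wkF ρ Γ) (ren⊢ (ext ρ) d))
ren⊢ ρ (∀E {φ = φ} d t) = cast (sym (inst-ren ρ φ t)) (∀E (ren⊢ ρ d) (renT ρ t))
ren⊢ ρ (∃I {φ = φ} t d) = ∃I (renT ρ t) (cast (inst-ren ρ φ t) (ren⊢ ρ d))
ren⊢ ρ {Γ} (∃E {φ = φ} {ψ = ψ} d e) =
  ∃E (ren⊢ ρ d) (cast (renF-ext-wkF ρ ψ) (castCtx (cong (renF (ext ρ) φ ∷_) (map-renF-ext-wkF ρ Γ)) (ren⊢ (ext ρ) e)))

wk⊢ : {φ : Formula n} → Ax ⊢[ Γ ] φ → Ax ⊢[ map wkF Γ ] wkF φ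
wk⊢ = ren⊢ suc

subF-≐ : (σ : Fin n → Term m) (t u : Term n) → subF σ (t ≐ u) ≡ (subT σ t ≐ subT σ u)
subF-≐ σ t u = cong₂ (λ a b → all ((v0 ∈' a) ⇔ (v0 ∈' b))) (subT-wk σ t) (subT-wk σ u)

subF-Subset : (σ : Fin n → Term m) (t u : Term n) → subF σ (Subset t u) ≡ Subset (subT σ t) (subT σ u)
subF-Subset σ t u = cong₂ (λ a b → all ((v0 ∈' a) ⇒ (v0 ∈' b))) (subT-wk σ t) (subT-wk σ u)

subF-LStable : (σ : Fin n → Term m) (C : Term n) → subF σ (LStable C) ≡ LStable (subT σ C)
subF-LStable σ C = cong (λ a → all (all (((v1 ∈' a) ∧' (v1 ≐ v0)) ⇒ (v0 ∈' a)))) (subT-wk2 σ C)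

subF-Transitive : (σ : Fin n → Term m) (D : Term n) → subF σ (Transitive D) ≡ Transitive (subT σ D)
subF-Transitive σ D = cong₂ (λ a b → all ((v0 ∈' a) ⇒ all ((v0 ∈' v1) ⇒ (v0 ∈' b)))) (subT-wk σ D) (subT-wk2 σ D)

subF-InTC : (σ : Fin n → Term m) (x C : Term n) → subF σ (InTC x C) ≡ InTC (subT σ x) (subT σ C)
subF-InTC σ x C = cong₂ (λ A b → all ((A ∧' Transitive v0) ⇒ (b ∈' v0)))
  (trans (subF-Subset (exts σ) (pair (wk C) (wk C)) v0) (cong (λ a → Subset (pair a a) v0) (subT-wk σ C)))
  (subT-wk σ x)

subF-TLS : (σ : Fin n → Term m) (C : Term n) → subF σ (TLS C) ≡ TLS (subT σ C)
subF-TLS σ C = cong (λ A → all (A ⇒ LStable v0)) (trans (subF-InTC (exts σ) v0 (wk C)) (cong (InTC v0) (subT-wk σ C)))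

wkF-natural : (F : ∀ {n} → Term n → Formula n) →
              (∀ {n m} (σ : Fin n → Term m) (t : Term n) → subF σ (F t) ≡ F (subT σ t)) →
              (t : Term n) → wkF (F t) ≡ F (wk t)
wkF-natural F subF-F t = trans (renF-sub suc (F t)) (trans (subF-F (var ∘ suc) t) (cong F (sym (renT-sub suc t))))

wkF-natural₂ : (F : ∀ {n} → Term n → Term n → Formula n) →
               (∀ {n m} (σ : Fin n → Term m) (t u : Term n) → subF σ (F t u) ≡ F (subT σ t) (subT σ u)) →
               (t u : Term n) → wkF (F t u) ≡ F (wk t) (wk u)
wkF-natural₂ F subF-F t u =
  trans (renF-sub suc (F t u)) (trans (subF-F (var ∘ suc) t u) (sym (cong₂ F (renT-sub suc t) (renT-sub suc u))))

wkF-≐ : (t u : Term n) → wkF (t ≐ u) ≡ (wk t ≐ wk u)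
wkF-≐ = wkF-natural₂ _≐_ subF-≐

wkF-Subset : (t u : Term n) → wkF (Subset t u) ≡ Subset (wk t) (wk u)
wkF-Subset = wkF-natural₂ Subset subF-Subset

wkF-InTC : (x C : Term n) → wkF (InTC x C) ≡ InTC (wk x) (wk C)
wkF-InTC = wkF-natural₂ InTC subF-InTC

wkF-LStable : (C : Term n) → wkF (LStable C) ≡ LStable (wk C)
wkF-LStable = wkF-natural LStable subF-LStable

wkF-Transitive : (D : Term n) → wkF (Transitive D) ≡ Transitive (wk D)
wkF-Transitive = wkF-natural Transitive subF-Transitive

wkF-TLS : (C : Term n) → wkF (TLS C) ≡ TLS (wk C)
wkF-TLS = wkF-natural TLS subF-TLS

h0 : {a : Formula n} → (a ∷ Γ) ⊢ a
h0 = hyp (here refl)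

h1 : {a b : Formula n} → (b ∷ a ∷ Γ) ⊢ a
h1 = hyp (there (here refl))

h2 : {a b c : Formula n} → (c ∷ b ∷ a ∷ Γ) ⊢ a
h2 = hyp (there (there (here refl)))

h3 : {a b c d : Formula n} → (d ∷ c ∷ b ∷ a ∷ Γ) ⊢ a
h3 = hyp (there (there (there (here refl))))

h4 : {a b c d e : Formula n} → (e ∷ d ∷ c ∷ b ∷ a ∷ Γ) ⊢ a
h4 = hyp (there (there (there (there (here refl)))))

h5 : {a b c d e f : Formula n} → (f ∷ e ∷ d ∷ c ∷ b ∷ a ∷ Γ) ⊢ a
h5 = hyp (there (there (there (there (there (here refl))))))

h6 : {a b c d e f g : Formula n} → (g ∷ f ∷ e ∷ d ∷ c ∷ b ∷ a ∷ Γ) ⊢ a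
h6 = hyp (there (there (there (there (there (there (here refl)))))))

w1 : {φ ψ : Formula n} → Γ ⊢ φ → (ψ ∷ Γ) ⊢ φ
w1 = weaken there

up : {φ ψ : Formula (suc n)} {χ : Formula n} → Γ ⊢ χ → wkF χ ≡ φ → (ψ ∷ map wkF Γ) ⊢ φ
up d e = w1 (cast e (wk⊢ d))

up² : {χ : Formula n} {φ a b : Formula (suc (suc n))} → Γ ⊢ χ → wkF (wkF χ) ≡ φ → (a ∷ b ∷ map wkF (map wkF Γ)) ⊢ φ
up² d e = w1 (w1 (cast e (wk⊢ (wk⊢ d))))

⊤' : Formula n
⊤' = ⊥' ⇒ ⊥'

⊤I : Γ ⊢ ⊤'
⊤I = ⇒I h0

⇔I : {φ ψ : Formula n} → (φ ∷ Γ) ⊢ ψ → (ψ ∷ Γ) ⊢ φ → Γ ⊢ φ ⇔ ψ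
⇔I d e = ∧I (⇒I d) (⇒I e)

⇔→ : {φ ψ : Formula n} → Γ ⊢ φ ⇔ ψ → Γ ⊢ φ → Γ ⊢ ψ
⇔→ d e = ⇒E (∧E₁ d) e

⇔← : {φ ψ : Formula n} → Γ ⊢ φ ⇔ ψ → Γ ⊢ ψ → Γ ⊢ φ
⇔← d e = ⇒E (∧E₂ d) e

∀E≡ : {φ : Formula (suc n)} {ψ : Formula n} → Γ ⊢ all φ → (t : Term n) → inst φ t ≡ ψ → Γ ⊢ ψ
∀E≡ d t e = cast e (∀E d t)

∃I≡ : {φ : Formula (suc n)} {ψ : Formula n} → (t : Term n) → inst φ t ≡ ψ → Γ ⊢ ψ → Γ ⊢ ex φ
∃I≡ t e d = ∃I t (cast (sym e) d)

∃E≡ : {φ : Formula (suc n)} {ψ : Formula n} {ψ' : Formula (suc n)} →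
      Γ ⊢ ex φ → wkF ψ ≡ ψ' → (φ ∷ map wkF Γ) ⊢ ψ' → Γ ⊢ ψ
∃E≡ d e f = ∃E d (cast (sym e) f)

inst-ext-suc-v0 : (φ : Formula (suc n)) → inst (renF (ext suc) φ) v0 ≡ φ
inst-ext-suc-v0 φ = trans (subF-renF (single v0) (ext suc) φ) (trans (subF-cong pw φ) (subF-id φ))
  where
  pw : single v0 ∘ ext suc ≗ var
  pw zero = refl
  pw (suc i) = refl

∀E-v0 : {φ : Formula (suc n)} → Γ ⊢ all φ → map wkF Γ ⊢ φ
∀E-v0 {φ = φ} d = ∀E≡ (wk⊢ d) v0 (inst-ext-suc-v0 φ)

∀-map : {φ ψ : Formula (suc n)} → Γ ⊢ all φ → (φ ∷ map wkF Γ) ⊢ ψ → Γ ⊢ all ψ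
∀-map d f = ∀I (⇒E (⇒I f) (∀E-v0 d))

∃-map : {φ ψ : Formula (suc n)} → Γ ⊢ ex φ → (φ ∷ map wkF Γ) ⊢ ψ → Γ ⊢ ex ψ
∃-map {ψ = ψ} d f = ∃E d (∃I≡ v0 (inst-ext-suc-v0 ψ) f)

allN-inst : (k : ℕ) (B : Formula k) (τ : Fin 0 → Term m) → Γ ⊢ subF τ (allN k B) →
            (σ : Fin k → Term m) → Γ ⊢ subF σ B
allN-inst zero B τ d σ = cast (subF-cong (λ ()) B) d
allN-inst (suc k) B τ d σ =
  ∀E≡ (allN-inst k (all B) τ d (σ ∘ suc)) (σ zero)
    (trans (subF-subF (single (σ zero)) (exts (σ ∘ suc)) B) (subF-cong e B))
  where
  e : subT (single (σ zero)) ∘ exts (σ ∘ suc) ≗ σ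
  e zero = refl
  e (suc i) = subT-single-wk (σ zero) (σ (suc i))

axiom-inst : (k : ℕ) (B : Formula k) → AxIZF⁻ (allN k B) → (σ : Fin k → Term m) → Γ ⊢ subF σ B
axiom-inst k B ax σ = allN-inst k B (var ∘ λ ()) (cast (renF-sub (λ ()) (allN k B)) (axm ax)) σ

axiom-open : (k : ℕ) (B : Formula k) → AxIZF⁻ (allN k B) → {Γ : List (Formula k)} → Γ ⊢ B
axiom-open k B ax = cast (subF-id B) (axiom-inst k B ax var)

args₁ : Term n → Fin 1 → Term n
args₁ a zero = a

args₂ : Term n → Term n → Fin 2 → Term n
args₂ a b zero = a
args₂ a b (suc zero) = b

args₃ : Term n → Term n → Term n → Fin 3 → Term n
args₃ a b c zero = a
args₃ a b c (suc zero) = b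
args₃ a b c (suc (suc zero)) = c

inst-≐ : (z t u : Term n) → inst ((v0 ∈' wk t) ⇔ (v0 ∈' wk u)) z ≡ ((z ∈' t) ⇔ (z ∈' u))
inst-≐ z t u = cong₂ (λ a b → (z ∈' a) ⇔ (z ∈' b)) (subT-single-wk z t) (subT-single-wk z u)

≐E : {z t u : Term n} → Γ ⊢ t ≐ u → Γ ⊢ z ∈' t → Γ ⊢ z ∈' u
≐E {z = z} {t} {u} d e = ⇔→ (∀E≡ d z (inst-≐ z t u)) e

≐E⁻ : {z t u : Term n} → Γ ⊢ t ≐ u → Γ ⊢ z ∈' u → Γ ⊢ z ∈' t
≐E⁻ {z = z} {t} {u} d e = ⇔← (∀E≡ d z (inst-≐ z t u)) e

≐I : {t u : Term n} → ((v0 ∈' wk t) ∷ map wkF Γ) ⊢ v0 ∈' wk u → ((v0 ∈' wk u) ∷ map wkF Γ) ⊢ v0 ∈' wk t →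
     Γ ⊢ t ≐ u
≐I d e = ∀I (⇔I d e)

up≐ : {t u : Term n} {ψ : Formula (suc n)} → Γ ⊢ t ≐ u → (ψ ∷ map wkF Γ) ⊢ wk t ≐ wk u
up≐ {t = t} {u} d = up d (wkF-≐ t u)

≐refl : (t : Term n) → Γ ⊢ t ≐ t
≐refl t = ≐I h0 h0

≐sym : {t u : Term n} → Γ ⊢ t ≐ u → Γ ⊢ u ≐ t
≐sym d = ≐I (≐E⁻ (up≐ d) h0) (≐E (up≐ d) h0)

≐trans : {t u s : Term n} → Γ ⊢ t ≐ u → Γ ⊢ u ≐ s → Γ ⊢ t ≐ s
≐trans d e = ≐I (≐E (up≐ e) (≐E (up≐ d) h0)) (≐E⁻ (up≐ d) (≐E⁻ (up≐ e) h0))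

wkF²-≐ : (t u : Term n) → wkF (wkF (t ≐ u)) ≡ (wk2 t ≐ wk2 u)
wkF²-≐ t u = trans (cong wkF (wkF-≐ t u)) (wkF-≐ (wk t) (wk u))

subsetE : {z s t : Term n} → Γ ⊢ Subset s t → Γ ⊢ z ∈' s → Γ ⊢ z ∈' t
subsetE {z = z} {s} {t} d e = ⇒E (∀E≡ d z (cong₂ (λ a b → (z ∈' a) ⇒ (z ∈' b)) (subT-single-wk z s) (subT-single-wk z t))) e

subsetI : {s t : Term n} → ((v0 ∈' wk s) ∷ map wkF Γ) ⊢ v0 ∈' wk t → Γ ⊢ Subset s t
subsetI d = ∀I (⇒I d)

Subset-resp-≐ˡ : {x y a : Term n} → Γ ⊢ Subset x a → Γ ⊢ x ≐ y → Γ ⊢ Subset y a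
Subset-resp-≐ˡ {x = x} {y} {a} s e = subsetI (subsetE (up s (wkF-Subset x a)) (≐E⁻ (up≐ e) h0))

Subset-resp-≐ʳ : {x a b : Term n} → Γ ⊢ Subset x a → Γ ⊢ a ≐ b → Γ ⊢ Subset x b
Subset-resp-≐ʳ {x = x} {a} s e = subsetI (≐E (up≐ e) (subsetE (up s (wkF-Subset x a)) h0))

transE : {a b D : Term n} → Γ ⊢ Transitive D → Γ ⊢ a ∈' D → Γ ⊢ b ∈' a → Γ ⊢ b ∈' D
transE {a = a} {b} {D} d e f =
  subsetE (⇒E (∀E≡ d a (cong₂ (λ x y → (a ∈' x) ⇒ all ((v0 ∈' wk a) ⇒ (v0 ∈' y)))
                 (subT-single-wk a D) (trans (subT-wk (single a) (wk D)) (cong wk (subT-single-wk a D))))) e) f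

LStableE : {A B C : Term n} → Γ ⊢ LStable C → Γ ⊢ A ∈' C → Γ ⊢ A ≐ B → Γ ⊢ B ∈' C
LStableE {n = n} {A = A} {B} {C} d e f = ⇒E (∀E≡ (∀E≡ d A refl) B eq) (∧I e f)
  where
  body : Formula (suc (suc n))
  body = ((v1 ∈' wk2 C) ∧' (v1 ≐ v0)) ⇒ (v0 ∈' wk2 C)
  τ : Fin (suc (suc n)) → Term n
  τ zero = B
  τ (suc zero) = A
  τ (suc (suc i)) = var i
  pw : subT (single B) ∘ exts (single A) ≗ τ
  pw zero = refl
  pw (suc zero) = subT-single-wk B A
  pw (suc (suc i)) = refl
  τ-wk2 : subT τ (wk2 C) ≡ C
  τ-wk2 = trans (subT-renT τ suc (wk C)) (trans (subT-renT (τ ∘ suc) suc C) (subT-id C))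
  eq : inst (subF (exts (single A)) body) B ≡ (((A ∈' C) ∧' (A ≐ B)) ⇒ (B ∈' C))
  eq = trans (subF-subF (single B) (exts (single A)) body)
       (trans (subF-cong pw body)
       (trans (cong (λ X → ((A ∈' subT τ (wk2 C)) ∧' X) ⇒ (B ∈' subT τ (wk2 C))) (subF-≐ τ v1 v0))
              (cong (λ c → ((A ∈' c) ∧' (A ≐ B)) ⇒ (B ∈' c)) τ-wk2)))

LStableI : {C : Term n} → ((v1 ∈' wk2 C) ∷ (v1 ≐ v0) ∷ map wkF (map wkF Γ)) ⊢ v0 ∈' wk2 C → Γ ⊢ LStable C
LStableI d = ∀I (∀I (⇒I (⇒E (⇒E (⇒I (⇒I (weaken (∷⁺ʳ _ (∷⁺ʳ _ there)) d))) (∧E₂ h0)) (∧E₁ h0))))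

wkF²-LStable : (t : Term n) → wkF (wkF (LStable t)) ≡ LStable (wk2 t)
wkF²-LStable t = trans (cong wkF (wkF-LStable t)) (wkF-LStable (wk t))

LStable-resp-≐ : {C C' : Term n} → Γ ⊢ LStable C → Γ ⊢ C ≐ C' → Γ ⊢ LStable C'
LStable-resp-≐ {C = C} {C'} d e =
  LStableI (≐E (up² e (wkF²-≐ C C')) (LStableE (up² d (wkF²-LStable C)) (≐E⁻ (up² e (wkF²-≐ C C')) h0) h1))

emptyE : {z : Term n} {φ : Formula n} → Γ ⊢ z ∈' ∅ → Γ ⊢ φ
emptyE {z = z} d = ⊥E (⇔→ (axiom-inst 1 ((v0 ∈' ∅) ⇔ ⊥') EMPTY (args₁ z)) d)

pairAx : (z a b : Term n) → Γ ⊢ (z ∈' pair a b) ⇔ ((z ≐ a) ∨' (z ≐ b))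
pairAx z a b =
  cast (cong₂ (λ X Y → (z ∈' pair a b) ⇔ (X ∨' Y)) (subF-≐ (args₃ z b a) v0 v2) (subF-≐ (args₃ z b a) v0 v1))
       (axiom-inst 3 ((v0 ∈' pair v2 v1) ⇔ ((v0 ≐ v2) ∨' (v0 ≐ v1))) PAIR (args₃ z b a))

pairE : {z a b : Term n} → Γ ⊢ z ∈' pair a b → Γ ⊢ (z ≐ a) ∨' (z ≐ b)
pairE {z = z} {a} {b} d = ⇔→ (pairAx z a b) d

singletonE : {z a : Term n} → Γ ⊢ z ∈' pair a a → Γ ⊢ z ≐ a
singletonE d = ∨E (pairE d) h0 h0

pairI₁ : {z a b : Term n} → Γ ⊢ z ≐ a → Γ ⊢ z ∈' pair a b
pairI₁ {z = z} {a} {b} d = ⇔← (pairAx z a b) (∨I₁ d)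

pairI₂ : {z a b : Term n} → Γ ⊢ z ≐ b → Γ ⊢ z ∈' pair a b
pairI₂ {z = z} {a} {b} d = ⇔← (pairAx z a b) (∨I₂ d)

unionAx : (z a : Term n) → Γ ⊢ (z ∈' ⋃ a) ⇔ ex ((v0 ∈' wk a) ∧' (wk z ∈' v0))
unionAx z a = axiom-inst 2 ((v0 ∈' ⋃ v1) ⇔ exIn v1 (v1 ∈' v0)) UNION (args₂ z a)

unionE : {z a : Term n} → Γ ⊢ z ∈' ⋃ a → Γ ⊢ ex ((v0 ∈' wk a) ∧' (wk z ∈' v0))
unionE {z = z} {a} d = ⇔→ (unionAx z a) d

unionI : {z y a : Term n} → Γ ⊢ y ∈' a → Γ ⊢ z ∈' y → Γ ⊢ z ∈' ⋃ a
unionI {z = z} {y} {a} d e = ⇔← (unionAx z a) (∃I≡ y (cong₂ (λ p q → (y ∈' p) ∧' (q ∈' y)) (subT-single-wk y a) (subT-single-wk y z)) (∧I d e))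

powerAx : (c a : Term n) → Γ ⊢ (c ∈' 𝒫 a) ⇔ Subset c a
powerAx c a = axiom-inst 2 ((v0 ∈' 𝒫 v1) ⇔ all ((v0 ∈' v1) ⇒ (v0 ∈' v2))) POWER (args₂ c a)

infAx : (z : Term n) → Γ ⊢ (z ∈' ω) ⇔ ((z ≐ ∅) ∨' ex ((v0 ∈' ω) ∧' (wk z ≐ Succ v0)))
infAx z = cast (cong₂ (λ X Y → (z ∈' ω) ⇔ (X ∨' ex ((v0 ∈' ω) ∧' Y))) (subF-≐ (args₁ z) v0 ∅) (subF-≐ (exts (args₁ z)) v1 (Succ v0)))
  (axiom-inst 1 ((v0 ∈' ω) ⇔ ((v0 ≐ ∅) ∨' exIn ω (v1 ≐ Succ v0))) INF (args₁ z))

infE : {z : Term n} → Γ ⊢ z ∈' ω → Γ ⊢ (z ≐ ∅) ∨' ex ((v0 ∈' ω) ∧' (wk z ≐ Succ v0))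
infE {z = z} d = ⇔→ (infAx z) d

infI-∅ : {z : Term n} → Γ ⊢ z ≐ ∅ → Γ ⊢ z ∈' ω
infI-∅ {z = z} d = ⇔← (infAx z) (∨I₁ d)

infI-succ : {z b : Term n} → Γ ⊢ b ∈' ω → Γ ⊢ z ≐ Succ b → Γ ⊢ z ∈' ω
infI-succ {z = z} {b} d e = ⇔← (infAx z) (∨I₂ (∃I≡ b (cong (λ X → (b ∈' ω) ∧' X) (trans (subF-≐ (single b) (wk z) (Succ v0)) (cong (λ q → q ≐ Succ b) (subT-single-wk b z)))) (∧I d e)))

succI-∈ : {z c : Term n} → Γ ⊢ z ∈' c → Γ ⊢ z ∈' Succ c
succI-∈ {c = c} d = unionI (pairI₁ (≐refl c)) d

succI-≐ : {z c : Term n} → Γ ⊢ z ≐ c → Γ ⊢ z ∈' Succ c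
succI-≐ {c = c} d = unionI (pairI₂ (≐refl (pair c c))) (pairI₁ d)

succE : {z c : Term n} → Γ ⊢ z ∈' Succ c → Γ ⊢ (z ∈' c) ∨' (z ≐ c)
succE {z = z} {c} d = ∃E≡ (unionE d) (cong (λ X → (wk z ∈' wk c) ∨' X) (wkF-≐ z c))
  (∨E (pairE (∧E₁ h0)) (∨I₁ (≐E h0 (∧E₂ h1))) (∨I₂ (singletonE (≐E h0 (∧E₂ h1)))))

cons : Term m → (Fin k → Term m) → Fin (suc k) → Term m
cons z f zero = z
cons z f (suc j) = f j

subV-tabulate : (σ : Fin n → Term m) (g : Fin k → Term n) → subV σ (tabulate g) ≡ tabulate (subT σ ∘ g)
subV-tabulate {k = zero} σ g = refl
subV-tabulate {k = suc k} σ g = cong (subT σ (g zero) ∷_) (subV-tabulate σ (g ∘ suc))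

subV-fs2 : (c a : Term m) (us : Vec (Term m) k) → subV (cons c (cons a (lookup us))) fs2 ≡ us
subV-fs2 c a us = trans (subV-tabulate (cons c (cons a (lookup us))) (λ i → var (suc (suc i)))) (tabulate∘lookup us)

sepAx : (φ : Formula (suc k)) (z a : Term m) (us : Vec (Term m) k) →
        Γ ⊢ (z ∈' sep φ a us) ⇔ ((z ∈' a) ∧' subF (cons z (lookup us)) φ)
sepAx {k = k} {m = m} φ z a us =
  cast (cong₂ (λ V X → (z ∈' sep φ a V) ⇔ ((z ∈' a) ∧' X)) (subV-fs2 z a us) (trans (subF-renF σ sepRen φ) (subF-cong pw φ)))
       (axiom-inst (suc (suc k)) ((v0 ∈' sep φ v1 fs2) ⇔ ((v0 ∈' v1) ∧' renF sepRen φ)) (SEP k φ) σ)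
  where
  σ : Fin (suc (suc k)) → Term m
  σ = cons z (cons a (lookup us))
  pw : σ ∘ sepRen ≗ cons z (lookup us)
  pw zero = refl
  pw (suc j) = refl

ind-axiom : (P : Formula 1) → Γ ⊢ subF {m = n} (λ ()) (INDax 0 P)
ind-axiom P = axiom-inst 0 (INDax 0 P) (IND 0 P) (λ ())

inst-InTC : (x C : Term n) → subF (single x) (InTC v0 (wk C)) ≡ InTC x C
inst-InTC x C = trans (subF-InTC (single x) v0 (wk C)) (cong (InTC x) (subT-single-wk x C))

TLSE : {x C : Term n} → Γ ⊢ TLS C → Γ ⊢ InTC x C → Γ ⊢ LStable x
TLSE {x = x} {C} d e = ⇒E (∀E≡ d x (cong₂ _⇒_ (inst-InTC x C) (subF-LStable (single x) v0))) e

TLSI : {C : Term n} → (InTC v0 (wk C) ∷ map wkF Γ) ⊢ LStable v0 → Γ ⊢ TLS C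
TLSI d = ∀I (⇒I d)

InTCE : {x C D : Term n} → Γ ⊢ InTC x C → Γ ⊢ Subset (pair C C) D → Γ ⊢ Transitive D → Γ ⊢ x ∈' D
InTCE {x = x} {C} {D} d e f = ⇒E (∀E≡ d D eq) (∧I e f)
  where
  eq : inst ((Subset (pair (wk C) (wk C)) v0 ∧' Transitive v0) ⇒ (wk x ∈' v0)) D ≡ ((Subset (pair C C) D ∧' Transitive D) ⇒ (x ∈' D))
  eq = cong₂ (λ A b → (A ∧' Transitive D) ⇒ (b ∈' D))
         (trans (subF-Subset (single D) (pair (wk C) (wk C)) v0) (cong (λ a → Subset (pair a a) D) (subT-single-wk D C)))
         (subT-single-wk D x)

InTCI : {x C : Term n} → ((Subset (pair (wk C) (wk C)) v0 ∧' Transitive v0) ∷ map wkF Γ) ⊢ wk x ∈' v0 → Γ ⊢ InTC x C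
InTCI d = ∀I (⇒I d)

InTC-refl : (C : Term n) → Γ ⊢ InTC C C
InTC-refl C = InTCI (subsetE (∧E₁ h0) (pairI₁ (≐refl (wk C))))

TLS⇒LStable : {C : Term n} → Γ ⊢ TLS C → Γ ⊢ LStable C
TLS⇒LStable {C = C} d = TLSE d (InTC-refl C)

TLS-resp-≐ : {C C' : Term n} → Γ ⊢ TLS C → Γ ⊢ C ≐ C' → Γ ⊢ TLS C'
TLS-resp-≐ {C = C} {C'} d e =
  TLSI (TLSE (up d (wkF-TLS C))
    (InTCI (InTCE (up h0 (wkF-InTC v0 (wk C')))
      (subsetI (subsetE (up (∧E₁ h0) (wkF-Subset _ _))
        (pairI₁ (≐trans (singletonE h0) (≐sym (up (up (up e (wkF-≐ C C')) (wkF-≐ _ _)) (wkF-≐ _ _)))))))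
      (∧E₂ h0))))

-- {x} ⊆ D for every transitive D ∋ c because the elements of {x} equal x ∈ c and c is L-stable.
TLS-∈ : {x c : Term n} → Γ ⊢ TLS c → Γ ⊢ x ∈' c → Γ ⊢ TLS x
TLS-∈ {x = x} {c} d e =
  TLSI (TLSE (up d (wkF-TLS c))
    (InTCI (InTCE (up h0 (wkF-InTC v0 (wk x)))
      (subsetI (transE (up (∧E₂ h0) (wkF-Transitive v0))
                       (subsetE (up (∧E₁ h0) (wkF-Subset _ _)) (pairI₁ (≐refl _)))
                       (LStableE (TLS⇒LStable (up (up (up d (wkF-TLS c)) (wkF-TLS _)) (wkF-TLS _)))
                                 (up (up (up e refl) refl) refl) (≐sym (singletonE h0)))))
      (∧E₂ h0))))

ω-LStable : Γ ⊢ LStable {n} ω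
ω-LStable = LStableI (∨E (infE h0) (infI-∅ (≐trans (≐sym h2) h0))
  (∃E≡ h0 refl (infI-succ (∧E₁ h0) (≐trans (≐sym h3) (∧E₂ h0)))))

ω-Transitive : Γ ⊢ Transitive {n} ω
ω-Transitive = ⇒E (ind-axiom ((v0 ∈' ω) ⇒ all ((v0 ∈' v1) ⇒ (v0 ∈' ω))))
  (∀I (⇒I (⇒I (∨E (infE h0)
    (∀I (⇒I (emptyE (≐E (up h0 refl) h0))))
    (∃E≡ h0 refl
      (∀I (⇒I (∨E (succE (≐E (∧E₂ h1) h0))
        (⇒E (∀E≡ (⇒E (⇒E (∀E≡ h5 v1 refl) (≐E⁻ (∧E₂ h2) (succI-≐ (≐refl v1)))) (∧E₁ h2)) v0 refl) h0)
        (LStableE ω-LStable (∧E₁ h2) (≐sym h0))))))))))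

ω-elements-LStable : Γ ⊢ all {n} ((v0 ∈' ω) ⇒ LStable v0)
ω-elements-LStable = ⇒E (ind-axiom ((v0 ∈' ω) ⇒ LStable v0))
  (∀I (⇒I (⇒I (LStableI (∨E (infE h2)
    (emptyE (≐E h0 h1))
    (∃E≡ h0 refl (∨E (succE (≐E (∧E₂ h0) h2))
      (≐E⁻ (∧E₂ h1) (succI-∈ (LStableE (⇒E (⇒E (∀E≡ h6 v0 refl) (≐E⁻ (∧E₂ h1) (succI-≐ (≐refl v0)))) (∧E₁ h1)) h0 h4)))
      (≐E⁻ (∧E₂ h1) (succI-≐ (≐trans (≐sym h4) h0))))))))))

-- TC({x}) ⊆ ω because ω is transitive and L-stable.
ω-∈-TLS : {x : Term n} → Γ ⊢ x ∈' ω → Γ ⊢ TLS x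
ω-∈-TLS d = TLSI (⇒E (∀E≡ ω-elements-LStable v0 refl)
  (InTCE h0 (subsetI (LStableE ω-LStable (up (up d refl) refl) (≐sym (singletonE h0)))) ω-Transitive))

Lev : ℕ → Term n → Formula n
Lev zero C = ⊤'
Lev (suc k) C = LStable C ∧' all ((v0 ∈' wk C) ⇒ Lev k v0)

subF-Lev : (k : ℕ) (σ : Fin n → Term m) (C : Term n) → subF σ (Lev k C) ≡ Lev k (subT σ C)
subF-Lev zero σ C = refl
subF-Lev (suc k) σ C =
  cong₂ _∧'_ (subF-LStable σ C) (cong₂ (λ a B → all ((v0 ∈' a) ⇒ B)) (subT-wk σ C) (subF-Lev k (exts σ) v0))

wkF-Lev : (k : ℕ) (C : Term n) → wkF (Lev k C) ≡ Lev k (wk C)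
wkF-Lev k = wkF-natural (Lev k) (subF-Lev k)

wkF²-Lev : (k : ℕ) (t : Term n) → wkF (wkF (Lev k t)) ≡ Lev k (wk2 t)
wkF²-Lev k t = trans (cong wkF (wkF-Lev k t)) (wkF-Lev k (wk t))

upLev : {k : ℕ} {t : Term n} {ψ : Formula (suc n)} → Γ ⊢ Lev k t → (ψ ∷ map wkF Γ) ⊢ Lev k (wk t)
upLev {k = k} {t} d = up d (wkF-Lev k t)

Lev-∈ : {k : ℕ} {x C : Term n} → Γ ⊢ Lev (suc k) C → Γ ⊢ x ∈' C → Γ ⊢ Lev k x
Lev-∈ {k = k} {x} {C} d e =
  ⇒E (∀E≡ (∧E₂ d) x (cong₂ (λ p q → (x ∈' p) ⇒ q) (subT-single-wk x C) (subF-Lev k (single x) v0))) e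

LevI : {k : ℕ} {C : Term n} → Γ ⊢ LStable C → ((v0 ∈' wk C) ∷ map wkF Γ) ⊢ Lev k v0 → Γ ⊢ Lev (suc k) C
LevI d e = ∧I d (∀I (⇒I e))

TLS⇒Lev : (k : ℕ) {C : Term n} → Γ ⊢ TLS C → Γ ⊢ Lev k C
TLS⇒Lev zero d = ⊤I
TLS⇒Lev (suc k) {C} d = LevI (TLS⇒LStable d) (TLS⇒Lev k (TLS-∈ (up d (wkF-TLS C)) h0))

Lev-resp-≐ : (k : ℕ) {C C' : Term n} → Γ ⊢ Lev k C → Γ ⊢ C ≐ C' → Γ ⊢ Lev k C'
Lev-resp-≐ zero d e = ⊤I
Lev-resp-≐ (suc k) {C} {C'} d e =
  LevI (LStable-resp-≐ (∧E₁ d) e) (Lev-∈ (up d (wkF-Lev (suc k) C)) (≐E⁻ (up e (wkF-≐ C C')) h0))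

Lev-≤ : {a b : ℕ} → b ≤ a → {C : Term n} → Γ ⊢ Lev a C → Γ ⊢ Lev b C
Lev-≤ z≤n d = ⊤I
Lev-≤ (s≤s p) {C} d = LevI (∧E₁ d) (Lev-≤ p (Lev-∈ (up d (wkF-Lev _ C)) h0))

∅-LStable : Γ ⊢ LStable {n} ∅
∅-LStable = LStableI (emptyE h0)

∅-Lev : (k : ℕ) → Γ ⊢ Lev {n} k ∅
∅-Lev zero = ⊤I
∅-Lev (suc k) = LevI ∅-LStable (emptyE h0)

ω-Lev : (k : ℕ) → Γ ⊢ Lev {n} k ω
ω-Lev zero = ⊤I
ω-Lev (suc k) = LevI ω-LStable (TLS⇒Lev k (ω-∈-TLS h0))

_≐ᵀ_ : Term n → Term n → Formula n
t ≐ᵀ u = all (TLS v0 ⇒ ((v0 ∈' wk t) ⇔ (v0 ∈' wk u)))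

infix 6 _≐ᵀ_

ElemsT : Term n → Formula n
ElemsT t = all ((v0 ∈' wk t) ⇒ TLS v0)

≐⇒≐ᵀ : {t u : Term n} → Γ ⊢ t ≐ u → Γ ⊢ t ≐ᵀ u
≐⇒≐ᵀ d = ∀I (⇒I (w1 (∀E-v0 d)))

≐ᵀ⇒≐ : {t u : Term n} → Γ ⊢ t ≐ᵀ u → Γ ⊢ ElemsT t → Γ ⊢ ElemsT u → Γ ⊢ t ≐ u
≐ᵀ⇒≐ d e f = ≐I (⇔→ (⇒E (w1 (∀E-v0 d)) (⇒E (w1 (∀E-v0 e)) h0)) h0)
                (⇔← (⇒E (w1 (∀E-v0 d)) (⇒E (w1 (∀E-v0 f)) h0)) h0)

TLS⇒ElemsT : {t : Term n} → Γ ⊢ TLS t → Γ ⊢ ElemsT t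
TLS⇒ElemsT {t = t} d = ∀I (⇒I (TLS-∈ (up d (wkF-TLS t)) h0))

∅-ElemsT : Γ ⊢ ElemsT {n} ∅
∅-ElemsT = ∀I (⇒I (emptyE h0))

Succ-ElemsT : {b : Term n} → Γ ⊢ TLS b → Γ ⊢ ElemsT (Succ b)
Succ-ElemsT {b = b} d = ∀I (⇒I (∨E (succE h0) (TLS-∈ (w1 (up d (wkF-TLS b))) h0) (TLS-resp-≐ (w1 (up d (wkF-TLS b))) (≐sym h0))))

relF-allN : (k : ℕ) (ψ : Formula k) →
            ((Γ : List (Formula k)) → (∀ i → Γ ⊢ TLS (var i)) → Γ ⊢ relF ψ) → [] ⊢ relF (allN k ψ)
relF-allN zero ψ f = f [] (λ ())
relF-allN (suc k) ψ f = relF-allN k (all ψ) (λ Γ hs → ∀I (⇒I (f (TLS v0 ∷ map wkF Γ) (hs′ Γ hs))))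
  where
  hs′ : (Γ : List (Formula k)) → (∀ i → Γ ⊢ TLS (var i)) → ∀ i → (TLS v0 ∷ map wkF Γ) ⊢ TLS (var i)
  hs′ Γ hs zero = h0
  hs′ Γ hs (suc i) = up (hs i) (wkF-TLS (var i))

relEMPTY : [] ⊢ relF EMPTYax
relEMPTY = ∀I (⇒I (⇔I (emptyE h0) (⊥E h0)))

relPAIR : [] ⊢ relF PAIRax
relPAIR = ∀I (⇒I (∀I (⇒I (∀I (⇒I (⇔I
  (∨E (pairE h0) (∨I₁ (≐⇒≐ᵀ h0)) (∨I₂ (≐⇒≐ᵀ h0)))
  (∨E h0 (pairI₁ (≐ᵀ⇒≐ h0 (TLS⇒ElemsT h2) (TLS⇒ElemsT h4))) (pairI₂ (≐ᵀ⇒≐ h0 (TLS⇒ElemsT h2) (TLS⇒ElemsT h3))))))))))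

relUNION : [] ⊢ relF UNIONax
relUNION = ∀I (⇒I (∀I (⇒I (⇔I
  (∃-map (unionE h0) (∧I (TLS-∈ h3 (∧E₁ h0)) h0))
  (∃E≡ h0 refl (unionI (∧E₁ (∧E₂ h0)) (∧E₂ (∧E₂ h0))))))))

relINF : [] ⊢ relF INFax
relINF = ∀I (⇒I (⇔I
  (∨E (infE h0) (∨I₁ (≐⇒≐ᵀ h0))
     (∨I₂ (∃-map h0 (∧I (ω-∈-TLS (∧E₁ h0)) (∧I (∧E₁ h0) (≐⇒≐ᵀ (∧E₂ h0)))))))
  (∨E h0 (infI-∅ (≐ᵀ⇒≐ h0 (TLS⇒ElemsT h2) ∅-ElemsT))
     (∃E≡ h0 refl (infI-succ (∧E₁ (∧E₂ h0)) (≐ᵀ⇒≐ (∧E₂ (∧E₂ h0)) (TLS⇒ElemsT h3) (Succ-ElemsT (∧E₁ h0))))))))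

𝒫ᵀ : Term n → Term n
𝒫ᵀ a = sep (TLS v0) (𝒫 a) []

𝒫ᵀI : {z a : Term n} → Γ ⊢ Subset z a → Γ ⊢ TLS z → Γ ⊢ z ∈' 𝒫ᵀ a
𝒫ᵀI s t = ⇔← (sepAx (TLS v0) _ _ []) (∧I (⇔← (powerAx _ _) s) t)

𝒫ᵀ-Subset : {z a : Term n} → Γ ⊢ z ∈' 𝒫ᵀ a → Γ ⊢ Subset z a
𝒫ᵀ-Subset d = ⇔→ (powerAx _ _) (∧E₁ (⇔→ (sepAx (TLS v0) _ _ []) d))

𝒫ᵀ-TLS : {z a : Term n} → Γ ⊢ z ∈' 𝒫ᵀ a → Γ ⊢ TLS z
𝒫ᵀ-TLS d = ∧E₂ (⇔→ (sepAx (TLS v0) _ _ []) d)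

relPOWER : [] ⊢ relF POWERax
relPOWER = ∀I (⇒I (∀I (⇒I (⇔I
  (∀I (⇒I (⇒I (subsetE (w1 (up (𝒫ᵀ-Subset h0) refl)) h0))))
  (𝒫ᵀI (subsetI (⇒E (⇒E (w1 (∀E-v0 h0)) (TLS-∈ (up h1 refl) h0)) h0)) h1)))))

relSEP : (k : ℕ) (φ : Formula (suc k)) → [] ⊢ relF (SEPax k φ)
relSEP k φ = relF-allN k _ (λ _ _ → ∀I (⇒I (∀I (⇒I (cast eq (axiom-open (suc (suc k)) _ (SEP k (relF φ))))))))
  where
  eq : ((v0 ∈' sep (relF φ) v1 fs2) ⇔ ((v0 ∈' v1) ∧' renF sepRen (relF φ)))
     ≡ ((v0 ∈' sep (relF φ) v1 (relV fs2)) ⇔ ((v0 ∈' v1) ∧' relF (renF sepRen φ)))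
  eq = cong₂ (λ V X → (v0 ∈' sep (relF φ) v1 V) ⇔ ((v0 ∈' v1) ∧' X)) (sym relV-fs2) (sym (relF-ren sepRen φ))

relIND : (k : ℕ) (φ : Formula (suc k)) → [] ⊢ relF (INDax k φ)
relIND k φ = relF-allN k _ (λ _ _ → ⇒I (⇒E (w1 (axiom-open k _ (IND k (TLS v0 ⇒ relF φ))))
  (∀-map h0 (⇒I (⇒I (⇒E (⇒E h2 h0) (∀-map h1 (⇒I (⇒I (cast (sym (relF-ren indRen φ)) (⇒E (⇒E h2 h0) h1)))))))))))

-- The relativized Replacement axiom for φ is the instance of Replacement for TLS(b) ∧ φᵀ,
-- up to moving the TLS guards across the quantifiers; c = v0 and a = v1 below.

∃!ᵀ⇒∃! : {Γ : List (Formula (suc (suc n)))} {Y : Formula (suc (suc (suc (suc n))))} → Γ ⊢ TLS v1 →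
  Γ ⊢ all (TLS v0 ⇒ ((v0 ∈' v2) ⇒ ex (TLS v0 ∧' (Y ∧' all (TLS v0 ⇒ (renF shift2 Y ⇒ v0 ≐ᵀ v1)))))) →
  Γ ⊢ all ((v0 ∈' v2) ⇒ ex ((TLS v0 ∧' Y) ∧' all ((TLS v0 ∧' renF shift2 Y) ⇒ (v0 ≐ v1))))
∃!ᵀ⇒∃! ta d = ∀-map d (⇒I (∃-map (⇒E (⇒E h1 (TLS-∈ (w1 (up ta refl)) h0)) h0)
  (∧I (∧I (∧E₁ h0) (∧E₁ (∧E₂ h0)))
      (∀-map (∧E₂ (∧E₂ h0)) (⇒I (≐ᵀ⇒≐ (⇒E (⇒E h1 (∧E₁ h0)) (∧E₂ h0)) (TLS⇒ElemsT (∧E₁ h0)) (TLS⇒ElemsT (∧E₁ h2))))))))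

∃!⇒∃!ᵀ : {Γ : List (Formula (suc (suc n)))} {Y : Formula (suc (suc (suc (suc n))))} →
  Γ ⊢ all ((v0 ∈' v2) ⇒ ex ((TLS v0 ∧' Y) ∧' all ((TLS v0 ∧' renF shift2 Y) ⇒ (v0 ≐ v1)))) →
  Γ ⊢ all (TLS v0 ⇒ ((v0 ∈' v2) ⇒ ex (TLS v0 ∧' (Y ∧' all (TLS v0 ⇒ (renF shift2 Y ⇒ v0 ≐ᵀ v1))))))
∃!⇒∃!ᵀ d = ∀-map d (⇒I (⇒I (∃-map (⇒E h2 h0)
  (∧I (∧E₁ (∧E₁ h0)) (∧I (∧E₂ (∧E₁ h0)) (∀-map (∧E₂ h0) (⇒I (⇒I (≐⇒≐ᵀ (⇒E h2 (∧I h1 h0)))))))))))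

∃∈ᵀ⇒∃∈ : {Γ : List (Formula (suc (suc n)))} {Z : Formula (suc (suc (suc n)))} → Γ ⊢ TLS v0 →
  Γ ⊢ ex (TLS v0 ∧' ((v0 ∈' v2) ∧' Z)) → Γ ⊢ ex ((v0 ∈' v2) ∧' (TLS v1 ∧' Z))
∃∈ᵀ⇒∃∈ tc d = ∃-map d (∧I (∧E₁ (∧E₂ h0)) (∧I (up tc refl) (∧E₂ (∧E₂ h0))))

∃∈⇒∃∈ᵀ : {Γ : List (Formula (suc (suc n)))} {Z : Formula (suc (suc (suc n)))} → Γ ⊢ TLS v1 →
  Γ ⊢ ex ((v0 ∈' v2) ∧' (TLS v1 ∧' Z)) → Γ ⊢ ex (TLS v0 ∧' ((v0 ∈' v2) ∧' Z))
∃∈⇒∃∈ᵀ ta d = ∃-map d (∧I (TLS-∈ (up ta refl) (∧E₁ h0)) (∧I (∧E₁ h0) (∧E₂ (∧E₂ h0))))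

relREPL : (k : ℕ) (φ : Formula (suc (suc k))) → [] ⊢ relF (REPLax k φ)
relREPL k φ = relF-allN k _ (λ _ _ → ∀I (⇒I (∀I (⇒I (cast (sym shape-relF)
  (⇔I (∧I (∃!⇒∃!ᵀ (∧E₁ (⇔→ (w1 ax) h0))) (∃∈⇒∃∈ᵀ (w1 h1) (∧E₂ (⇔→ (w1 ax) h0))))
      (⇔← (w1 ax) (∧I (∃!ᵀ⇒∃! (w1 h1) (∧E₁ h0)) (∃∈ᵀ⇒∃∈ (w1 h0) (∧E₂ h0))))))))))
  where
  ψ : Formula (suc (suc k))
  ψ = TLS v1 ∧' relF φ
  ax : {Δ : List (Formula (suc (suc k)))} →
       Δ ⊢ (v0 ∈' rep ψ v1 fs2) ⇔ (allIn v1 (ex! (renF replRen1 ψ)) ∧' exIn v1 (renF replRen2 ψ))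
  ax = axiom-open (suc (suc k)) _ (REPL k ψ)
  shape : Vec (Term (suc (suc k))) k → Formula (suc (suc (suc (suc k)))) →
          Formula (suc (suc (suc (suc (suc k))))) → Formula (suc (suc (suc k))) → Formula (suc (suc k))
  shape V Y Y' Z = (v0 ∈' rep ψ v1 V) ⇔ (all (TLS v0 ⇒ ((v0 ∈' v2) ⇒ ex (TLS v0 ∧' (Y ∧' all (TLS v0 ⇒ (Y' ⇒ v0 ≐ᵀ v1))))))
                                          ∧' ex (TLS v0 ∧' ((v0 ∈' v2) ∧' Z)))
  shape-relF : shape (relV fs2) (relF (renF replRen1 φ)) (relF (renF shift2 (renF replRen1 φ))) (relF (renF replRen2 φ))
             ≡ shape fs2 (renF replRen1 (relF φ)) (renF shift2 (renF replRen1 (relF φ))) (renF replRen2 (relF φ))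
  shape-relF = cong₄ shape relV-fs2 (relF-ren replRen1 φ)
    (trans (relF-ren shift2 (renF replRen1 φ)) (cong (renF shift2) (relF-ren replRen1 φ))) (relF-ren replRen2 φ)

pair-LStable : {a b : Term n} → Γ ⊢ LStable (pair a b)
pair-LStable = LStableI (∨E (pairE h0) (pairI₁ (≐trans (≐sym h2) h0)) (pairI₂ (≐trans (≐sym h2) h0)))

pair-Lev : (e : ℕ) {a b : Term n} → Γ ⊢ Lev e a → Γ ⊢ Lev e b → Γ ⊢ Lev (suc e) (pair a b)
pair-Lev e da db =
  LevI pair-LStable (∨E (pairE h0) (Lev-resp-≐ e (w1 (upLev da)) (≐sym h0)) (Lev-resp-≐ e (w1 (upLev db)) (≐sym h0)))

pair-cong : {a₁ a₂ b₁ b₂ : Term n} → Γ ⊢ a₁ ≐ a₂ → Γ ⊢ b₁ ≐ b₂ → Γ ⊢ pair a₁ b₁ ≐ pair a₂ b₂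
pair-cong ea eb = ≐I
  (∨E (pairE h0) (pairI₁ (≐trans h0 (w1 (up≐ ea)))) (pairI₂ (≐trans h0 (w1 (up≐ eb)))))
  (∨E (pairE h0) (pairI₁ (≐trans h0 (≐sym (w1 (up≐ ea))))) (pairI₂ (≐trans h0 (≐sym (w1 (up≐ eb))))))

union-Lev : (e : ℕ) {a : Term n} → Γ ⊢ Lev (suc (suc e)) a → Γ ⊢ Lev (suc e) (⋃ a)
union-Lev e {a} da = LevI
  (LStableI (∃E≡ (unionE h0) refl (unionI (∧E₁ h0)
      (LStableE (∧E₁ (Lev-∈ (up (up² da (wkF²-Lev _ a)) (wkF-Lev _ (wk2 a))) (∧E₁ h0))) (∧E₂ h0) h2))))
  (∃E≡ (unionE h0) (wkF-Lev e v0) (Lev-∈ (Lev-∈ (upLev (upLev da)) (∧E₁ h0)) (∧E₂ h0)))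

union-cong : {a₁ a₂ : Term n} → Γ ⊢ a₁ ≐ a₂ → Γ ⊢ ⋃ a₁ ≐ ⋃ a₂
union-cong ea = ≐I
  (∃E≡ (unionE h0) refl (unionI (≐E (up (up≐ ea) (wkF-≐ _ _)) (∧E₁ h0)) (∧E₂ h0)))
  (∃E≡ (unionE h0) refl (unionI (≐E⁻ (up (up≐ ea) (wkF-≐ _ _)) (∧E₁ h0)) (∧E₂ h0)))

𝒫ᵀ-LStable : {a : Term n} → Γ ⊢ LStable (𝒫ᵀ a)
𝒫ᵀ-LStable = LStableI (𝒫ᵀI (Subset-resp-≐ˡ (𝒫ᵀ-Subset h0) h1) (TLS-resp-≐ (𝒫ᵀ-TLS h0) h1))

𝒫ᵀ-Lev : (k : ℕ) {a : Term n} → Γ ⊢ Lev k (𝒫ᵀ a)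
𝒫ᵀ-Lev zero = ⊤I
𝒫ᵀ-Lev (suc k) = LevI 𝒫ᵀ-LStable (TLS⇒Lev k (𝒫ᵀ-TLS h0))

𝒫ᵀ-cong : {a₁ a₂ : Term n} → Γ ⊢ a₁ ≐ a₂ → Γ ⊢ 𝒫ᵀ a₁ ≐ 𝒫ᵀ a₂
𝒫ᵀ-cong ea = ≐I (𝒫ᵀI (Subset-resp-≐ʳ (𝒫ᵀ-Subset h0) (up≐ ea)) (𝒫ᵀ-TLS h0))
                (𝒫ᵀI (Subset-resp-≐ʳ (𝒫ᵀ-Subset h0) (≐sym (up≐ ea))) (𝒫ᵀ-TLS h0))

Levs : ℕ → (Fin n → Term m) → List (Formula m) → Set
Levs Lv σ Γ = ∀ i → Γ ⊢ Lev Lv (σ i)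

record Agree {n m : ℕ} (Lv : ℕ) (σ₁ σ₂ : Fin n → Term m) (Γ : List (Formula m)) : Set where
  constructor agree
  field
    eqs   : ∀ i → Γ ⊢ σ₁ i ≐ σ₂ i
    levs₁ : Levs Lv σ₁ Γ
    levs₂ : Levs Lv σ₂ Γ

open Agree

Transports : Formula n → ℕ → Set
Transports {n} ψ Lv =
  ∀ {m} {Γ : List (Formula m)} (σ₁ σ₂ : Fin n → Term m) → Agree Lv σ₁ σ₂ Γ → Γ ⊢ subF σ₁ ψ ⇒ subF σ₂ ψ

module _ {Lv : ℕ} {σ₁ σ₂ : Fin n → Term m} where

  Agree-sym : Agree Lv σ₁ σ₂ Γ → Agree Lv σ₂ σ₁ Γ
  Agree-sym r = agree (λ i → ≐sym (eqs r i)) (levs₂ r) (levs₁ r)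

  Agree-resp-≗ : {τ₁ τ₂ : Fin n → Term m} → σ₁ ≗ τ₁ → σ₂ ≗ τ₂ → Agree Lv σ₁ σ₂ Γ → Agree Lv τ₁ τ₂ Γ
  Agree-resp-≗ e₁ e₂ r = agree (λ i → cast (cong₂ _≐_ (e₁ i) (e₂ i)) (eqs r i))
                               (λ i → cast (cong (Lev Lv) (e₁ i)) (levs₁ r i))
                               (λ i → cast (cong (Lev Lv) (e₂ i)) (levs₂ r i))

  Agree-w1 : {ψ : Formula m} → Agree Lv σ₁ σ₂ Γ → Agree Lv σ₁ σ₂ (ψ ∷ Γ)
  Agree-w1 r = agree (λ i → w1 (eqs r i)) (λ i → w1 (levs₁ r i)) (λ i → w1 (levs₂ r i))

  Agree-↑ : Agree Lv σ₁ σ₂ Γ → Agree Lv (wk ∘ σ₁) (wk ∘ σ₂) (map wkF Γ)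
  Agree-↑ r = agree (λ i → cast (wkF-≐ _ _) (wk⊢ (eqs r i)))
                    (λ i → cast (wkF-Lev Lv _) (wk⊢ (levs₁ r i)))
                    (λ i → cast (wkF-Lev Lv _) (wk⊢ (levs₂ r i)))

Agree-wk : {Lv : ℕ} {σ₁ σ₂ : Fin n → Term m} {ψ : Formula (suc m)} →
           Agree Lv σ₁ σ₂ Γ → Agree Lv (wk ∘ σ₁) (wk ∘ σ₂) (ψ ∷ map wkF Γ)
Agree-wk r = Agree-w1 (Agree-↑ r)

Agree-refl : {Lv : ℕ} {σ : Fin n → Term m} → Levs Lv σ Γ → Agree Lv σ σ Γ
Agree-refl ls = agree (λ i → ≐refl _) ls ls

cons-Agree : {Lv : ℕ} {z₁ z₂ : Term m} {σ₁ σ₂ : Fin k → Term m} →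
             Γ ⊢ z₁ ≐ z₂ → Γ ⊢ Lev Lv z₁ → Γ ⊢ Lev Lv z₂ → Agree Lv σ₁ σ₂ Γ → Agree Lv (cons z₁ σ₁) (cons z₂ σ₂) Γ
cons-Agree e l₁ l₂ r = agree (λ { zero → e ; (suc i) → eqs r i })
                             (λ { zero → l₁ ; (suc i) → levs₁ r i })
                             (λ { zero → l₂ ; (suc i) → levs₂ r i })

cons-Agree-refl : {Lv : ℕ} {z : Term m} {σ₁ σ₂ : Fin k → Term m} →
                  Γ ⊢ Lev Lv z → Agree Lv σ₁ σ₂ Γ → Agree Lv (cons z σ₁) (cons z σ₂) Γ
cons-Agree-refl l r = cons-Agree (≐refl _) l l r

Agree-exts : {Lv : ℕ} {σ₁ σ₂ : Fin n → Term m} → Agree Lv σ₁ σ₂ Γ → Agree Lv (exts σ₁) (exts σ₂) (TLS v0 ∷ map wkF Γ)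
Agree-exts r = Agree-resp-≗ cons-exts cons-exts
  (cons-Agree-refl (TLS⇒Lev _ h0) (Agree-wk r))
  where
  cons-exts : {σ : Fin n → Term m} → cons v0 (wk ∘ σ) ≗ exts σ
  cons-exts zero = refl
  cons-exts (suc i) = refl

lookup-renV : (ρ : Fin n → Fin m) (us : Vec (Term n) k) (j : Fin k) → lookup (renV ρ us) j ≡ renT ρ (lookup us j)
lookup-renV ρ (u ∷ us) zero = refl
lookup-renV ρ (u ∷ us) (suc j) = lookup-renV ρ us j

Agree-lookup-↑ : {Lv : ℕ} (us₁ us₂ : Vec (Term m) k) → Agree Lv (lookup us₁) (lookup us₂) Γ →
                 Agree Lv (lookup (renV suc us₁)) (lookup (renV suc us₂)) (map wkF Γ)
Agree-lookup-↑ us₁ us₂ r =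
  Agree-resp-≗ (λ j → sym (lookup-renV suc us₁ j)) (λ j → sym (lookup-renV suc us₂ j)) (Agree-↑ r)

Agree-lookup-wk : {Lv : ℕ} (us₁ us₂ : Vec (Term m) k) {ψ : Formula (suc m)} → Agree Lv (lookup us₁) (lookup us₂) Γ →
                  Agree Lv (lookup (renV suc us₁)) (lookup (renV suc us₂)) (ψ ∷ map wkF Γ)
Agree-lookup-wk us₁ us₂ r = Agree-w1 (Agree-lookup-↑ us₁ us₂ r)

sep-∈-resp : (ψ : Formula (suc k)) (Lv : ℕ) → Transports ψ Lv → {z₁ z₂ a₁ a₂ : Term m} {us₁ us₂ : Vec (Term m) k} →
             Γ ⊢ z₁ ≐ z₂ → Γ ⊢ a₁ ≐ a₂ → Γ ⊢ Lev (suc Lv) a₁ → Agree Lv (lookup us₁) (lookup us₂) Γ →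
             Γ ⊢ z₁ ∈' sep ψ a₁ us₁ → Γ ⊢ z₂ ∈' sep ψ a₂ us₂
sep-∈-resp {Γ = Γ} ψ Lv transport {z₁} {z₂} {a₁} {a₂} {us₁} {us₂} ez ea la r d =
  ⇔← (sepAx ψ z₂ a₂ us₂)
     (∧I (≐E ea (LStableE (∧E₁ la) (∧E₁ body) ez))
         (⇒E (transport (cons z₁ (lookup us₁)) (cons z₂ (lookup us₂)) (cons-Agree ez lz (Lev-resp-≐ Lv lz ez) r))
             (∧E₂ body)))
  where
  body : Γ ⊢ (z₁ ∈' a₁) ∧' subF (cons z₁ (lookup us₁)) ψ
  body = ⇔→ (sepAx ψ z₁ a₁ us₁) d
  lz : Γ ⊢ Lev Lv z₁
  lz = Lev-∈ la (∧E₁ body)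

sep-cong : (ψ : Formula (suc k)) (Lv : ℕ) → Transports ψ Lv → {a₁ a₂ : Term m} {us₁ us₂ : Vec (Term m) k} →
           Γ ⊢ a₁ ≐ a₂ → Γ ⊢ Lev (suc Lv) a₁ → Γ ⊢ Lev (suc Lv) a₂ → Agree Lv (lookup us₁) (lookup us₂) Γ →
           Γ ⊢ sep ψ a₁ us₁ ≐ sep ψ a₂ us₂
sep-cong ψ Lv transport {us₁ = us₁} {us₂} ea la₁ la₂ r =
  ≐I (sep-∈-resp ψ Lv transport (≐refl v0) (up≐ ea) (upLev la₁) (Agree-lookup-wk us₁ us₂ r) h0)
     (sep-∈-resp ψ Lv transport (≐refl v0) (≐sym (up≐ ea)) (upLev la₂) (Agree-lookup-wk us₂ us₁ (Agree-sym r)) h0)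

sep-LStable : (ψ : Formula (suc k)) (Lv : ℕ) → Transports ψ Lv → {a : Term m} {us : Vec (Term m) k} →
              Γ ⊢ Lev (suc Lv) a → Levs Lv (lookup us) Γ → Γ ⊢ LStable (sep ψ a us)
sep-LStable ψ Lv transport {a} {us} la ls = LStableI
  (sep-∈-resp ψ Lv transport h1 (≐refl (wk2 a)) (up² la (wkF²-Lev _ a))
     (Agree-w1 (Agree-w1 (Agree-lookup-↑ (renV suc us) (renV suc us) (Agree-lookup-↑ us us (Agree-refl ls))))) h0)

sep-Lev : (ψ : Formula (suc k)) (Lv e : ℕ) → Transports ψ Lv → {a : Term m} {us : Vec (Term m) k} →
          Γ ⊢ Lev (suc Lv) a → Γ ⊢ Lev (suc e) a → Levs Lv (lookup us) Γ → Γ ⊢ Lev (suc e) (sep ψ a us)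
sep-Lev ψ Lv e transport {a} {us} la la′ ls =
  LevI (sep-LStable ψ Lv transport la ls) (Lev-∈ (upLev la′) (∧E₁ (⇔→ (sepAx ψ v0 (wk a) (renV suc us)) h0)))

-- Argument lists for the Replacement body: in ReplTotal x = v1 and y = v0 (resp. v2 and v0
-- in the uniqueness clause), in ReplImage x = v0 and b = c.
totalArgs : (Fin k → Term m) → Fin (suc (suc k)) → Term (suc (suc m))
totalArgs f = cons v1 (cons v0 (wk2 ∘ f))

totalArgs′ : (Fin k → Term m) → Fin (suc (suc k)) → Term (suc (suc (suc m)))
totalArgs′ f = cons v2 (cons v0 (wk ∘ wk2 ∘ f))

imageArgs : Term m → (Fin k → Term m) → Fin (suc (suc k)) → Term (suc m)
imageArgs c f = cons v0 (cons (wk c) (wk ∘ f))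

ReplTotal : (ψ : Formula (suc (suc k))) → Term m → (Fin k → Term m) → Formula m
ReplTotal ψ a f = all ((v0 ∈' wk a) ⇒ ex ((TLS v0 ∧' subF (totalArgs f) ψ) ∧' all ((TLS v0 ∧' subF (totalArgs′ f) ψ) ⇒ (v0 ≐ v1))))

ReplImage : (ψ : Formula (suc (suc k))) → Term m → Term m → (Fin k → Term m) → Formula m
ReplImage ψ c a f = ex ((v0 ∈' wk a) ∧' (TLS (wk c) ∧' subF (imageArgs c f) ψ))

repAx : (ψ : Formula (suc (suc k))) (c a : Term m) (us : Vec (Term m) k) →
        Γ ⊢ (c ∈' rep (TLS v1 ∧' ψ) a us) ⇔ (ReplTotal ψ a (lookup us) ∧' ReplImage ψ c a (lookup us))
repAx {k = k} {m = m} ψ c a us =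
  cast (cong₄ (λ V X Y Z → (c ∈' rep (TLS v1 ∧' ψ) a V) ⇔
                 (all ((v0 ∈' wk a) ⇒ ex ((TLS v0 ∧' X) ∧' all ((TLS v0 ∧' Y) ⇒ (v0 ≐ v1))))
                  ∧' ex ((v0 ∈' wk a) ∧' (TLS (wk c) ∧' Z))))
         (subV-fs2 c a us)
         (trans (subF-renF (exts (exts σ)) replRen1 ψ) (subF-cong pA ψ))
         (trans (subF-renF (exts (exts (exts σ))) shift2 (renF replRen1 ψ))
                (trans (subF-renF _ replRen1 ψ) (subF-cong pA′ ψ)))
         (trans (subF-renF (exts σ) replRen2 ψ) (subF-cong pE ψ)))
       (axiom-inst (suc (suc k)) _ (REPL k (TLS v1 ∧' ψ)) σ)
  where
  σ : Fin (suc (suc k)) → Term m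
  σ = cons c (cons a (lookup us))
  pA : exts (exts σ) ∘ replRen1 ≗ totalArgs (lookup us)
  pA zero = refl
  pA (suc zero) = refl
  pA (suc (suc j)) = refl
  pA′ : exts (exts (exts σ)) ∘ shift2 ∘ replRen1 ≗ totalArgs′ (lookup us)
  pA′ zero = refl
  pA′ (suc zero) = refl
  pA′ (suc (suc j)) = refl
  pE : exts σ ∘ replRen2 ≗ imageArgs c (lookup us)
  pE zero = refl
  pE (suc zero) = refl
  pE (suc (suc j)) = refl

ReplTotal-resp : (ψ : Formula (suc (suc k))) (Lv : ℕ) → Transports ψ Lv → {a₁ a₂ : Term m} {f₁ f₂ : Fin k → Term m} →
                 Γ ⊢ a₁ ≐ a₂ → Γ ⊢ Lev (suc Lv) a₂ → Agree Lv f₁ f₂ Γ → Γ ⊢ ReplTotal ψ a₁ f₁ → Γ ⊢ ReplTotal ψ a₂ f₂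
ReplTotal-resp ψ Lv transport {f₁ = f₁} {f₂} ea la₂ r d =
  ∀-map d (⇒I (∃-map (⇒E h1 (≐E⁻ (w1 (up≐ ea)) h0))
    (∧I (∧I (∧E₁ (∧E₁ h0))
            (⇒E (transport (totalArgs f₁) (totalArgs f₂)
                   (cons-Agree-refl (Lev-∈ (upLev (w1 (upLev la₂))) h1)
                     (cons-Agree-refl (TLS⇒Lev Lv (∧E₁ (∧E₁ h0))) (Agree-wk (Agree-w1 (Agree-wk r))))))
                (∧E₂ (∧E₁ h0))))
        (∀-map (∧E₂ h0) (⇒I (⇒E h1 (∧I (∧E₁ h0)
          (⇒E (transport (totalArgs′ f₂) (totalArgs′ f₁)
                 (cons-Agree-refl (Lev-∈ (w1 (upLev (upLev (w1 (upLev la₂))))) h3)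
                   (cons-Agree-refl (TLS⇒Lev Lv (∧E₁ h0))
                     (Agree-w1 (Agree-wk (Agree-wk (Agree-w1 (Agree-wk (Agree-sym r)))))))))
              (∧E₂ h0)))))))))

ReplImage-resp : (ψ : Formula (suc (suc k))) (Lv : ℕ) → Transports ψ Lv →
                 {c₁ c₂ a₁ a₂ : Term m} {f₁ f₂ : Fin k → Term m} →
                 Γ ⊢ c₁ ≐ c₂ → Γ ⊢ a₁ ≐ a₂ → Γ ⊢ Lev (suc Lv) a₁ → Agree Lv f₁ f₂ Γ →
                 Γ ⊢ ReplImage ψ c₁ a₁ f₁ → Γ ⊢ ReplImage ψ c₂ a₂ f₂
ReplImage-resp {Γ = Γ} ψ Lv transport {c₁} {c₂} {a₁} {f₁ = f₁} {f₂} ec ea la₁ r d =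
  ∃-map d (∧I (≐E (up≐ ea) (∧E₁ h0))
              (∧I tc₂ (⇒E (transport (imageArgs c₁ f₁) (imageArgs c₂ f₂)
                         (cons-Agree-refl (Lev-∈ (upLev la₁) (∧E₁ h0))
                           (cons-Agree (up≐ ec) (TLS⇒Lev Lv (∧E₁ (∧E₂ h0))) (TLS⇒Lev Lv tc₂) (Agree-wk r))))
                      (∧E₂ (∧E₂ h0)))))
  where
  tc₂ : ((v0 ∈' wk a₁) ∧' (TLS (wk c₁) ∧' subF (imageArgs c₁ f₁) ψ)) ∷ map wkF Γ ⊢ TLS (wk c₂)
  tc₂ = TLS-resp-≐ (∧E₁ (∧E₂ h0)) (up≐ ec)

rep-∈-resp : (ψ : Formula (suc (suc k))) (Lv : ℕ) → Transports ψ Lv → {c₁ c₂ a₁ a₂ : Term m} {us₁ us₂ : Vec (Term m) k} →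
             Γ ⊢ c₁ ≐ c₂ → Γ ⊢ a₁ ≐ a₂ → Γ ⊢ Lev (suc Lv) a₁ → Γ ⊢ Lev (suc Lv) a₂ → Agree Lv (lookup us₁) (lookup us₂) Γ →
             Γ ⊢ c₁ ∈' rep (TLS v1 ∧' ψ) a₁ us₁ → Γ ⊢ c₂ ∈' rep (TLS v1 ∧' ψ) a₂ us₂
rep-∈-resp ψ Lv transport {c₁} {c₂} {a₁} {a₂} {us₁} {us₂} ec ea la₁ la₂ r d =
  ⇔← (repAx ψ c₂ a₂ us₂)
     (∧I (ReplTotal-resp ψ Lv transport ea la₂ r (∧E₁ (⇔→ (repAx ψ c₁ a₁ us₁) d)))
         (ReplImage-resp ψ Lv transport ec ea la₁ r (∧E₂ (⇔→ (repAx ψ c₁ a₁ us₁) d))))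

rep-cong : (ψ : Formula (suc (suc k))) (Lv : ℕ) → Transports ψ Lv → {a₁ a₂ : Term m} {us₁ us₂ : Vec (Term m) k} →
           Γ ⊢ a₁ ≐ a₂ → Γ ⊢ Lev (suc Lv) a₁ → Γ ⊢ Lev (suc Lv) a₂ → Agree Lv (lookup us₁) (lookup us₂) Γ →
           Γ ⊢ rep (TLS v1 ∧' ψ) a₁ us₁ ≐ rep (TLS v1 ∧' ψ) a₂ us₂
rep-cong ψ Lv transport {us₁ = us₁} {us₂} ea la₁ la₂ r =
  ≐I (rep-∈-resp ψ Lv transport (≐refl v0) (up≐ ea) (upLev la₁) (upLev la₂) (Agree-lookup-wk us₁ us₂ r) h0)
     (rep-∈-resp ψ Lv transport (≐refl v0) (≐sym (up≐ ea)) (upLev la₂) (upLev la₁) (Agree-lookup-wk us₂ us₁ (Agree-sym r)) h0)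

rep-LStable : (ψ : Formula (suc (suc k))) (Lv : ℕ) → Transports ψ Lv → {a : Term m} {us : Vec (Term m) k} →
              Γ ⊢ Lev (suc Lv) a → Levs Lv (lookup us) Γ → Γ ⊢ LStable (rep (TLS v1 ∧' ψ) a us)
rep-LStable ψ Lv transport {a} {us} la ls = LStableI
  (rep-∈-resp ψ Lv transport h1 (≐refl (wk2 a)) (up² la (wkF²-Lev _ a)) (up² la (wkF²-Lev _ a))
     (Agree-w1 (Agree-w1 (Agree-lookup-↑ (renV suc us) (renV suc us) (Agree-lookup-↑ us us (Agree-refl ls))))) h0)

-- Elements of a replacement term are in T by the guard TLS(b), so they have every level.
rep-Lev : (ψ : Formula (suc (suc k))) (Lv e : ℕ) → Transports ψ Lv → {a : Term m} {us : Vec (Term m) k} →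
          Γ ⊢ Lev (suc Lv) a → Levs Lv (lookup us) Γ → Γ ⊢ Lev (suc e) (rep (TLS v1 ∧' ψ) a us)
rep-Lev ψ Lv e transport {a} {us} la ls =
  LevI (rep-LStable ψ Lv transport la ls)
       (TLS⇒Lev e (∃E≡ (∧E₂ (⇔→ (repAx ψ v0 (wk a) (renV suc us)) h0)) refl (∧E₁ (∧E₂ h0))))

mutual
  depth : Term n → ℕ
  depth (var i) = 0
  depth ∅ = 0
  depth ω = 0
  depth (pair t u) = depth t + depth u
  depth (⋃ t) = suc (depth t)
  depth (𝒫 t) = depth t
  depth (sep φ t us) = (depth t + suc (depthF φ)) + (depthV us + depthF φ)
  depth (rep φ t us) = (depth t + suc (depthF φ)) + (depthV us + depthF φ)

  depthV : Vec (Term n) k → ℕ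
  depthV [] = 0
  depthV (u ∷ us) = depth u + depthV us

  depthF : Formula n → ℕ
  depthF (t ∈' s) = depth t + (depth s + 1)
  depthF ⊥' = 0
  depthF (φ ∧' ψ) = depthF φ + depthF ψ
  depthF (φ ∨' ψ) = depthF φ + depthF ψ
  depthF (φ ⇒ ψ) = depthF φ + depthF ψ
  depthF (all φ) = depthF φ
  depthF (ex φ) = depthF φ

Levs-≤ : {a b : ℕ} {σ : Fin n → Term m} → a ≤ b → Levs b σ Γ → Levs a σ Γ
Levs-≤ p ls i = Lev-≤ p (ls i)

Agree-≤ : {a b : ℕ} {σ₁ σ₂ : Fin n → Term m} → a ≤ b → Agree b σ₁ σ₂ Γ → Agree a σ₁ σ₂ Γ
Agree-≤ p r = agree (eqs r) (Levs-≤ p (levs₁ r)) (Levs-≤ p (levs₂ r))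

mutual
  relT-Lev : (t : Term n) (e : ℕ) (σ : Fin n → Term m) → Levs (depth t + e) σ Γ → Γ ⊢ Lev e (subT σ (relT t))
  relT-Lev (var i) e σ ls = ls i
  relT-Lev ∅ e σ ls = ∅-Lev e
  relT-Lev ω e σ ls = ω-Lev e
  relT-Lev (pair t u) zero σ ls = ⊤I
  relT-Lev (pair t u) (suc e) σ ls =
    pair-Lev e (relT-Lev t e σ (Levs-≤ (+-mono-≤ (m≤m+n (depth t) (depth u)) (n≤1+n e)) ls))
               (relT-Lev u e σ (Levs-≤ (+-mono-≤ (m≤n+m (depth u) (depth t)) (n≤1+n e)) ls))
  relT-Lev (⋃ t) zero σ ls = ⊤I
  relT-Lev (⋃ t) (suc e) σ ls = union-Lev e (relT-Lev t (suc (suc e)) σ (Levs-≤ (≤-reflexive (+-suc (depth t) (suc e))) ls))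
  relT-Lev (𝒫 t) e σ ls = 𝒫ᵀ-Lev e
  relT-Lev (sep φ t us) zero σ ls = ⊤I
  relT-Lev (sep φ t us) (suc e) σ ls =
    sep-Lev (relF φ) (depthF φ) e (relF-transport φ)
      (relT-Lev t (suc (depthF φ)) σ (Levs-≤ (m≤n⇒m≤n+o (suc e) (m≤m+n _ _)) ls))
      (relT-Lev t (suc e) σ (Levs-≤ (+-monoˡ-≤ (suc e) (m≤n⇒m≤n+o (depthV us + depthF φ) (m≤m+n _ _))) ls))
      (relV-Lev us (depthF φ) σ (Levs-≤ (m≤n⇒m≤n+o (suc e) (m≤n+m _ (depth t + suc (depthF φ)))) ls))
  relT-Lev (rep φ t us) zero σ ls = ⊤I
  relT-Lev (rep φ t us) (suc e) σ ls =
    rep-Lev (relF φ) (depthF φ) e (relF-transport φ)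
      (relT-Lev t (suc (depthF φ)) σ (Levs-≤ (m≤n⇒m≤n+o (suc e) (m≤m+n _ _)) ls))
      (relV-Lev us (depthF φ) σ (Levs-≤ (m≤n⇒m≤n+o (suc e) (m≤n+m _ (depth t + suc (depthF φ)))) ls))

  relV-Lev : (us : Vec (Term n) k) (e : ℕ) (σ : Fin n → Term m) → Levs (depthV us + e) σ Γ →
             Levs e (lookup (subV σ (relV us))) Γ
  relV-Lev (u ∷ us) e σ ls zero = relT-Lev u e σ (Levs-≤ (+-monoˡ-≤ e (m≤m+n _ _)) ls)
  relV-Lev (u ∷ us) e σ ls (suc j) = relV-Lev us e σ (Levs-≤ (+-monoˡ-≤ e (m≤n+m _ (depth u))) ls) j

  relT-cong : (t : Term n) (σ₁ σ₂ : Fin n → Term m) → Agree (depth t) σ₁ σ₂ Γ →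
              Γ ⊢ subT σ₁ (relT t) ≐ subT σ₂ (relT t)
  relT-cong (var i) σ₁ σ₂ r = eqs r i
  relT-cong ∅ σ₁ σ₂ r = ≐refl ∅
  relT-cong ω σ₁ σ₂ r = ≐refl ω
  relT-cong (pair t u) σ₁ σ₂ r =
    pair-cong (relT-cong t σ₁ σ₂ (Agree-≤ (m≤m+n _ _) r)) (relT-cong u σ₁ σ₂ (Agree-≤ (m≤n+m _ _) r))
  relT-cong (⋃ t) σ₁ σ₂ r = union-cong (relT-cong t σ₁ σ₂ (Agree-≤ (n≤1+n _) r))
  relT-cong (𝒫 t) σ₁ σ₂ r = 𝒫ᵀ-cong (relT-cong t σ₁ σ₂ r)
  relT-cong (sep φ t us) σ₁ σ₂ r =
    sep-cong (relF φ) (depthF φ) (relF-transport φ)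
      (relT-cong t σ₁ σ₂ (Agree-≤ (m≤n⇒m≤n+o _ (m≤m+n _ _)) r))
      (relT-Lev t (suc (depthF φ)) σ₁ (Levs-≤ (m≤m+n _ _) (levs₁ r)))
      (relT-Lev t (suc (depthF φ)) σ₂ (Levs-≤ (m≤m+n _ _) (levs₂ r)))
      (relV-Agree us (depthF φ) σ₁ σ₂ (Agree-≤ (m≤n+m _ (depth t + suc (depthF φ))) r))
  relT-cong (rep φ t us) σ₁ σ₂ r =
    rep-cong (relF φ) (depthF φ) (relF-transport φ)
      (relT-cong t σ₁ σ₂ (Agree-≤ (m≤n⇒m≤n+o _ (m≤m+n _ _)) r))
      (relT-Lev t (suc (depthF φ)) σ₁ (Levs-≤ (m≤m+n _ _) (levs₁ r)))
      (relT-Lev t (suc (depthF φ)) σ₂ (Levs-≤ (m≤m+n _ _) (levs₂ r)))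
      (relV-Agree us (depthF φ) σ₁ σ₂ (Agree-≤ (m≤n+m _ (depth t + suc (depthF φ))) r))

  relV-cong : (us : Vec (Term n) k) (σ₁ σ₂ : Fin n → Term m) → Agree (depthV us) σ₁ σ₂ Γ →
              ∀ j → Γ ⊢ lookup (subV σ₁ (relV us)) j ≐ lookup (subV σ₂ (relV us)) j
  relV-cong (u ∷ us) σ₁ σ₂ r zero = relT-cong u σ₁ σ₂ (Agree-≤ (m≤m+n _ _) r)
  relV-cong (u ∷ us) σ₁ σ₂ r (suc j) = relV-cong us σ₁ σ₂ (Agree-≤ (m≤n+m _ (depth u)) r) j

  relV-Agree : (us : Vec (Term n) k) (e : ℕ) (σ₁ σ₂ : Fin n → Term m) → Agree (depthV us + e) σ₁ σ₂ Γ →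
               Agree e (lookup (subV σ₁ (relV us))) (lookup (subV σ₂ (relV us))) Γ
  relV-Agree us e σ₁ σ₂ r =
    agree (relV-cong us σ₁ σ₂ (Agree-≤ (m≤m+n _ e) r)) (relV-Lev us e σ₁ (levs₁ r)) (relV-Lev us e σ₂ (levs₂ r))

  relF-transport : (φ : Formula n) → Transports (relF φ) (depthF φ)
  relF-transport (t ∈' s) σ₁ σ₂ r =
    ⇒I (LStableE (∧E₁ (w1 (relT-Lev s 1 σ₂ (Levs-≤ (m≤n+m _ (depth t)) (levs₂ r)))))
                 (≐E (w1 (relT-cong s σ₁ σ₂ (Agree-≤ (≤-trans (m≤m+n (depth s) 1) (m≤n+m _ (depth t))) r))) h0)
                 (w1 (relT-cong t σ₁ σ₂ (Agree-≤ (m≤m+n _ _) r))))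
  relF-transport ⊥' σ₁ σ₂ r = ⇒I h0
  relF-transport (φ ∧' ψ) σ₁ σ₂ r =
    ⇒I (∧I (⇒E (w1 (relF-transport φ σ₁ σ₂ (Agree-≤ (m≤m+n _ _) r))) (∧E₁ h0))
           (⇒E (w1 (relF-transport ψ σ₁ σ₂ (Agree-≤ (m≤n+m _ (depthF φ)) r))) (∧E₂ h0)))
  relF-transport (φ ∨' ψ) σ₁ σ₂ r =
    ⇒I (∨E h0 (∨I₁ (⇒E (w1 (w1 (relF-transport φ σ₁ σ₂ (Agree-≤ (m≤m+n _ _) r)))) h0))
              (∨I₂ (⇒E (w1 (w1 (relF-transport ψ σ₁ σ₂ (Agree-≤ (m≤n+m _ (depthF φ)) r)))) h0)))
  relF-transport (φ ⇒ ψ) σ₁ σ₂ r =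
    ⇒I (⇒I (⇒E (w1 (w1 (relF-transport ψ σ₁ σ₂ (Agree-≤ (m≤n+m _ (depthF φ)) r))))
               (⇒E h1 (⇒E (w1 (w1 (relF-transport φ σ₂ σ₁ (Agree-sym (Agree-≤ (m≤m+n _ _) r))))) h0))))
  relF-transport (all φ) σ₁ σ₂ r =
    ⇒I (∀I (⇒I (⇒E (weaken (∷⁺ʳ _ there) (relF-transport φ (exts σ₁) (exts σ₂) (Agree-exts r)))
                   (⇒E (w1 (∀E-v0 h0)) h0))))
  relF-transport (ex φ) σ₁ σ₂ r =
    ⇒I (∃-map h0 (∧I (∧E₁ h0)
      (⇒E (⇒E (weaken (there ∘ there) (⇒I (relF-transport φ (exts σ₁) (exts σ₂) (Agree-exts r)))) (∧E₁ h0)) (∧E₂ h0))))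

-- Inside T the hypothesis a =ᵀ b yields a = b, and all variables lie in T, so they have every level.
relL : (k : ℕ) (φ : Formula (suc k)) → [] ⊢ relF (Lax k φ)
relL k φ = relF-allN k _ (λ Γ hs → ∀I (⇒I (∀I (⇒I (⇒I (⇒I
  (cast (sym (relF-renF leibRenB))
        (⇒E (w1 (relF-transport φ (var ∘ leibRenA) (var ∘ leibRenB) (agreement Γ hs)))
            (cast (relF-renF leibRenA) h0)))))))))
  where
  relF-renF : (ρ : Fin (suc k) → Fin (suc (suc k))) → relF (renF ρ φ) ≡ subF (var ∘ ρ) (relF φ)
  relF-renF ρ = trans (relF-ren ρ φ) (renF-sub ρ (relF φ))
  Ctx : List (Formula k) → List (Formula (suc (suc k)))
  Ctx Γ = v1 ≐ᵀ v0 ∷ TLS v0 ∷ map wkF (TLS v0 ∷ map wkF Γ)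
  params-TLS : (Γ : List (Formula k)) → (∀ i → Γ ⊢ TLS (var i)) → ∀ i → Ctx Γ ⊢ TLS (var (suc (suc i)))
  params-TLS Γ hs i = w1 (up (up (hs i) (wkF-TLS _)) (wkF-TLS _))
  agreement : (Γ : List (Formula k)) → (∀ i → Γ ⊢ TLS (var i)) →
              Agree (depthF φ) (var ∘ leibRenA) (var ∘ leibRenB) (Ctx Γ)
  agreement Γ hs = agree (λ { zero → ≐ᵀ⇒≐ h0 (TLS⇒ElemsT h2) (TLS⇒ElemsT h1) ; (suc i) → ≐refl _ })
                         (λ { zero → TLS⇒Lev _ h2 ; (suc i) → TLS⇒Lev _ (params-TLS Γ hs i) })
                         (λ { zero → TLS⇒Lev _ h1 ; (suc i) → TLS⇒Lev _ (params-TLS Γ hs i) })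

theorem8p11 : (χ : Formula 0) → AxIZF χ → AxIZF⁻ ⊢[ [] ] relF χ
theorem8p11 _ (base EMPTY) = relEMPTY
theorem8p11 _ (base PAIR) = relPAIR
theorem8p11 _ (base INF) = relINF
theorem8p11 _ (base UNION) = relUNION
theorem8p11 _ (base POWER) = relPOWER
theorem8p11 _ (base (SEP k φ)) = relSEP k φ
theorem8p11 _ (base (REPL k φ)) = relREPL k φ
theorem8p11 _ (base (IND k φ)) = relIND k φ
theorem8p11 _ (L k φ) = relL k φ
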